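{- For any r-forest $\mathcal F$ of $G$, there is a $\hat G$-r-forest $\hat{\mathcal F}$ such that $\hat F(\hat{\mathcal F})\le F(\mathcal F)$ and $\hat{\mathcal F}$ has at most $2r-2$ non-terminal vertices.
   Context: Let $G=(V,E)$ be a connected undirected network with edge lengths $c_e>0$, and let $\mathcal R$ be a set of $r\ge 2$ unordered pairs of distinct vertices (relevant pairs); a vertex belonging to some relevant pair is a terminal vertex. Let $\Phi$ be a function of the vector of connection times $(t_p)_{p\in\mathcal R}$ that is non-decreasing in each coordinate. For a network $H$ with edge lengths, given a sequence $(e_1,\dots,e_f)$ of distinct edges of $H$, edge $e_k$ completes at time $C_k=\sum_{j\le k}c_{e_j}$ and the connection time $t_{\{u,v\}}$ is the smallest $C_k$ such that $u,v$ are connected using only $e_1,\dots,e_k$. An r-forest of $H$ is a set of edges of $H$ forming a forest (acyclic subnetwork, vertices being the endpoints of its edges) such that every relevant pair $\{u,v\}$ is connected in it by a (unique) path $P(u,v)$, and every edge of it lies on $P(u,v)$ for some relevant pair $\{u,v\}$. For an r-forest $\mathcal F$ of $G$, $F(\mathcal F)$ is the minimum of $\Phi((t_p)_{p\in\mathcal R})$ over all orderings of the edges of $\mathcal F$. The metric closure $\hat G$ of $G$ is the complete network on $V$ in which the length of edge $(u,v)$ is the shortest-path distance between $u$ and $v$ in $G$. A $\hat G$-r-forest is an r-forest of $\hat G$, and for it $\hat F(\hat{\mathcal F})$ is the minimum of $\Phi((t_p)_{p\in\mathcal R})$ over all orderings of its edges, using lengths in $\hat G$. A non-terminal vertex of a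 forest is one of its vertices not belonging to any relevant pair.
   Formalization: The edge lengths $c_e$, the shortest-path distances and the connection times are rational, and the objective Φ is a non-decreasing function from rational vectors to the rationals. -}

module Defs where

open import Data.Nat using (ℕ; zero; suc; _≥_; _∸_; _*_)
open import Data.Fin using (Fin)
open import Data.Fin.Properties using () renaming (_≟_ to _≟F_)
open import Data.Rational using (ℚ; 0ℚ; _+_) renaming (_≤_ to _≤ℚ_; _<_ to _<ℚ_)
open import Data.List using (List; []; _∷_; _++_; [_]; length; take; map; foldr; concatMap; filter; allFin)
open import Data.List.Membership.Propositional using (_∈_)
import Data.List.Membership.DecPropositional as DecMem
open import Data.List.Relation.Unary.All using (All)
open import Data.List.Relation.Unary.AllPairs using (AllPairs)
open import Data.List.Relation.Unary.Linked using (Linked)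
open import Data.List.Relation.Unary.Unique.Propositional using (Unique)
open import Data.List.Relation.Binary.Permutation.Propositional using (_↭_)
open import Data.Product using (Σ; ∃; ∃-syntax; _×_; _,_; proj₁; proj₂)
open import Data.Sum using (_⊎_)
open import Data.Empty using (⊥)
open import Relation.Nullary using (¬_; Dec)
open import Relation.Nullary.Decidable using (_×-dec_; ¬?)
open import Relation.Binary.PropositionalEquality using (_≡_; _≢_)

-- Vertices are Fin n.  Edges are (ordered representatives of)
-- unordered pairs of vertices.

Edge : ℕ → Set
Edge n = Fin n × Fin n

-- A network on vertex set Fin n: an adjacency relation and a length
-- function (only meaningful on adjacent pairs).
record Network (n : ℕ) : Set₁ where
  field
    Adj : Fin n → Fin n → Set
    len : Fin n → Fin n → ℚ
open Network public

IsUndirectedNetwork : ∀ {n} → Network n → Set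
IsUndirectedNetwork {n} G =
  (∀ (u v : Fin n) → Adj G u v → Adj G v u) ×
  (∀ (u : Fin n) → ¬ Adj G u u) ×
  (∀ (u v : Fin n) → Adj G u v → len G u v ≡ len G v u) ×
  (∀ (u v : Fin n) → Adj G u v → 0ℚ <ℚ len G u v)

lastOr : ∀ {A : Set} → A → List A → A
lastOr x []       = x
lastOr x (y ∷ ys) = lastOr y ys

Ends : ∀ {n} → Fin n → Fin n → List (Fin n) → Set
Ends u v []       = ⊥
Ends u v (x ∷ xs) = (u ≡ x) × (lastOr x xs ≡ v)

IsPath : ∀ {n} → (Fin n → Fin n → Set) → Fin n → Fin n → List (Fin n) → Set
IsPath J u v ws = Ends u v ws × Unique ws × Linked J ws

pathLen : ∀ {n} → Network n → List (Fin n) → ℚ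
pathLen H (x ∷ y ∷ ws) = len H x y + pathLen H (y ∷ ws)
pathLen H _            = 0ℚ

Connected : ∀ {n} → Network n → Set
Connected {n} G = ∀ (u v : Fin n) → ∃[ ws ] IsPath (Adj G) u v ws

IsDist : ∀ {n} → Network n → Fin n → Fin n → ℚ → Set
IsDist G u v x =
  (∃[ ws ] (IsPath (Adj G) u v ws × pathLen G ws ≡ x)) ×
  (∀ ws → IsPath (Adj G) u v ws → x ≤ℚ pathLen G ws)

closure : ∀ {n} → (Fin n → Fin n → ℚ) → Network n
closure {n} d = record { Adj = λ u v → u ≢ v ; len = d }

SameEdge : ∀ {n} → Edge n → Edge n → Set
SameEdge (u , v) (u' , v') = (u ≡ u' × v ≡ v') ⊎ (u ≡ v' × v ≡ u')

EdgeIn : ∀ {n} → List (Edge n) → Fin n → Fin n → Set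
EdgeIn E u v = ∃[ e ] (e ∈ E × SameEdge e (u , v))

Consec : ∀ {n} → List (Fin n) → Fin n → Fin n → Set
Consec (x ∷ y ∷ ws) a b = (a ≡ x × b ≡ y) ⊎ Consec (y ∷ ws) a b
Consec _            a b = ⊥

EdgeOnPath : ∀ {n} → Edge n → List (Fin n) → Set
EdgeOnPath e ws = ∃[ a ] ∃[ b ] (Consec ws a b × SameEdge e (a , b))

IsCycle : ∀ {n} → List (Edge n) → Fin n → List (Fin n) → Set
IsCycle E x xs = (length xs ≥ 2) × Unique (x ∷ xs) × Linked (EdgeIn E) (x ∷ xs ++ [ x ])

Acyclic : ∀ {n} → List (Edge n) → Set
Acyclic E = ∀ x xs → ¬ IsCycle E x xs

ConnIn : ∀ {n} → List (Edge n) → Fin n → Fin n → Set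
ConnIn E u v = ∃[ ws ] IsPath (EdgeIn E) u v ws

EdgeList : ∀ {n} → Network n → List (Edge n) → Set
EdgeList H E = All (λ e → Adj H (proj₁ e) (proj₂ e)) E × AllPairs (λ e e' → ¬ SameEdge e e') E

IsRForest : ∀ {n r} → Network n → (Fin r → Edge n) → List (Edge n) → Set
IsRForest {n} {r} H R F =
  EdgeList H F ×
  Acyclic F ×
  (∀ (i : Fin r) → ConnIn F (proj₁ (R i)) (proj₂ (R i))) ×
  (∀ e → e ∈ F → ∃[ i ] ∃[ ws ]
     (IsPath (EdgeIn F) (proj₁ (R i)) (proj₂ (R i)) ws × EdgeOnPath e ws))

completion : ∀ {n} → Network n → List (Edge n) → ℕ → ℚ
completion H σ k = foldr _+_ 0ℚ (map (λ e → len H (proj₁ e) (proj₂ e)) (take k σ))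

IsConnTime : ∀ {n} → Network n → List (Edge n) → Edge n → ℚ → Set
IsConnTime H σ (u , v) x =
  (∃[ k ] (ConnIn (take k σ) u v × completion H σ k ≡ x)) ×
  (∀ k → ConnIn (take k σ) u v → x ≤ℚ completion H σ k)

OrderingValue : ∀ {n r} → Network n → (Fin r → Edge n) → ((Fin r → ℚ) → ℚ) →
                List (Edge n) → List (Edge n) → ℚ → Set
OrderingValue {r = r} H R Φ F σ y =
  (σ ↭ F) × ∃[ t ] ((∀ (i : Fin r) → IsConnTime H σ (R i) (t i)) × Φ t ≡ y)

IsFValue : ∀ {n r} → Network n → (Fin r → Edge n) → ((Fin r → ℚ) → ℚ) →
           List (Edge n) → ℚ → Set
IsFValue H R Φ F x =
  (∃[ σ ] OrderingValue H R Φ F σ x) ×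
  (∀ σ y → OrderingValue H R Φ F σ y → x ≤ℚ y)

Monotone : ∀ {r} → ((Fin r → ℚ) → ℚ) → Set
Monotone {r} Φ = ∀ (t t' : Fin r → ℚ) → (∀ i → t i ≤ℚ t' i) → Φ t ≤ℚ Φ t'

ValidPairs : ∀ {n r} → (Fin r → Edge n) → Set
ValidPairs {n} {r} R =
  (∀ (i : Fin r) → proj₁ (R i) ≢ proj₂ (R i)) ×
  (∀ (i j : Fin r) → SameEdge (R i) (R j) → i ≡ j)

terminals : ∀ {n r} → (Fin r → Edge n) → List (Fin n)
terminals {r = r} R = concatMap (λ i → proj₁ (R i) ∷ proj₂ (R i) ∷ []) (allFin r)

forestVertices : ∀ {n} → List (Edge n) → List (Fin n)
forestVertices F = concatMap (λ e → proj₁ e ∷ proj₂ e ∷ []) F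

isNonTerminal? : ∀ {n r} (R : Fin r → Edge n) (F : List (Edge n)) (v : Fin n) →
                 Dec (v ∈ forestVertices F × ¬ v ∈ terminals R)
isNonTerminal? {n} R F v =
  DecMem._∈?_ (_≟F_ {n}) v (forestVertices F) ×-dec ¬? (DecMem._∈?_ (_≟F_ {n}) v (terminals R))

numNonTerminal : ∀ {n r} → (Fin r → Edge n) → List (Edge n) → ℕ
numNonTerminal {n} R F = length (filter (isNonTerminal? R F) (allFin n))

-- Take an optimal ordering of the edges of 𝓕 and read its edges in the metric closure Ĝ, where no
-- edge is longer. As long as the forest has a non-terminal vertex v of degree two, with neighbours a
-- and b, replace the edges a–v and v–b by the edge a–b of Ĝ, put in place of the later of the two.
-- Every relevant path through v keeps its ends, so the result is again an r-forest, and every prefix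
-- of the ordering becomes one that still connects the same relevant pairs and, by the triangle
-- inequality, is no longer; as Φ is monotone, the optimal value of the final forest is at most F(𝓕).
-- In the final forest every non-terminal vertex has degree at least three, so with N non-terminal
-- and T terminal vertices and E edges, 3N + T ≤ 2E and E + 1 ≤ N + T, whence N ≤ T − 2 ≤ 2r − 2.

module Submission where

open import Defs
open import Data.Empty using (⊥; ⊥-elim)
open import Data.Fin using (Fin)
import Data.Fin
open import Data.Fin.Properties using (_≟_)
open import Data.List using (List; []; _∷_; _++_; [_]; length; filter; allFin; map; concatMap; foldr; take; drop; reverse)
open import Data.List.Membership.Propositional using (_∈_; _∉_; find)
import Data.List.Membership.DecPropositional as DecMembership
open import Data.List.Membership.Propositional.Properties
  using (∈-∃++; ∈-++⁺ˡ; ∈-++⁺ʳ; ∈-++⁻; ∈-allFin; ∈-filter⁺; ∈-filter⁻; ∈-concatMap⁺; ∈-concatMap⁻;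
         ∈-map⁺; ∈-map⁻; ∈-length)
open import Data.List.Properties
  using (++-assoc; ∷-injective; unfold-reverse; reverse-++; reverse-involutive; filter-none; filter-accept; filter-++;
         length-tabulate; take++drop≡id; take-all)
open import Data.List.Relation.Binary.Permutation.Propositional
  using (_↭_; ↭-refl; ↭-sym; ↭-trans; ↭-reflexive; ↭-prep; ↭-swap; ↭⇒↭ₛ)
import Data.List.Relation.Binary.Permutation.Propositional as ↭
open import Data.List.Relation.Binary.Permutation.Propositional.Properties
  using (All-resp-↭; ∈-resp-↭; shift; ↭-length; ↭-reverse; drop-mid; ↭-empty-inv)
import Data.List.Relation.Binary.Permutation.Setoid.Properties as PermutationSetoid
open import Data.List.Relation.Binary.Subset.Propositional using (_⊆_)
open import Data.List.Relation.Unary.All using (All; []; _∷_)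
import Data.List.Relation.Unary.All as All
open import Data.List.Relation.Unary.All.Properties using (¬Any⇒All¬; ++⁻ˡ; ++⁺)
open import Data.List.Relation.Unary.AllPairs using (AllPairs; []; _∷_; allPairs?)
open import Data.List.Relation.Unary.Any using (here; there; any?; satisfied)
import Data.List.Relation.Unary.Any as Any
open import Data.List.Relation.Unary.Linked as Linked using (Linked; []; [-]; _∷_; linked?)
open import Data.List.Relation.Unary.Unique.Propositional using (Unique)
open import Data.List.Relation.Unary.Unique.Propositional.Properties using (allFin⁺)
import Data.List.Relation.Unary.Unique.Propositional.Properties as Unique
open import Data.Nat as ℕ using (ℕ; zero; suc; _+_; _*_; _∸_; _≤_; _≥_; _<_; z≤n; s≤s)
open import Data.Nat.Induction using (<-wellFounded)
open import Data.Nat.ListAction using (sum)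
import Data.Nat.Properties as ℕ
open import Algebra.Properties.CommutativeSemigroup ℕ.+-commutativeSemigroup using (interchange)
open import Data.Nat.Solver using (module +-*-Solver)
open import Data.Product using (∃; ∃-syntax; _×_; _,_; proj₁; proj₂)
open import Data.Rational using (ℚ; 0ℚ) renaming (_+_ to _+ℚ_; _≤_ to _≤ℚ_)
import Data.Rational.Properties as ℚ
open import Data.Sum using (_⊎_; inj₁; inj₂)
import Data.Sum
open import Function using (id; _∘_)
open import Induction.WellFounded using (Acc; acc)
import Relation.Binary.Bundles
open import Data.List.Extrema (Relation.Binary.Bundles.DecTotalOrder.totalOrder ℚ.≤-decTotalOrder)
  using (argmin; argmin-sel; f[argmin]≤f[xs])
open import Relation.Binary.PropositionalEquality as ≡ using (_≡_; _≢_; refl; sym; trans; cong; cong₂; subst)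
open import Relation.Nullary using (¬_; Dec; yes; no)
open import Relation.Nullary.Decidable using (_×-dec_; _⊎-dec_; ¬?)
open import Relation.Unary using (Decidable)

private
  variable
    n r : ℕ
    A : Set

_∈?_ : (x : Fin n) (xs : List (Fin n)) → Dec (x ∈ xs)
_∈?_ = DecMembership._∈?_ _≟_

x≤y+x : ∀ {x y} → 0ℚ ≤ℚ y → x ≤ℚ y +ℚ x
x≤y+x {x} {y} 0≤y = subst (_≤ℚ y +ℚ x) (ℚ.+-identityˡ x) (ℚ.+-monoˡ-≤ x 0≤y)

-- Paths as vertex lists

lastOr-++ : ∀ (z : A) as x bs → lastOr z (as ++ x ∷ bs) ≡ lastOr x bs
lastOr-++ z []       x bs = refl
lastOr-++ z (a ∷ as) x bs = lastOr-++ a as x bs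

lastOr-∈ : ∀ (x : A) xs → lastOr x xs ∈ x ∷ xs
lastOr-∈ x []       = here refl
lastOr-∈ x (y ∷ xs) = there (lastOr-∈ y xs)

init-last : ∀ (x : A) xs → ∃ λ ini → x ∷ xs ≡ ini ++ [ lastOr x xs ]
init-last x []       = [] , refl
init-last x (y ∷ xs) with ini , eq ← init-last y xs = x ∷ ini , cong (x ∷_) eq

All-++⁻-mid : ∀ {P : A → Set} as {z bs} → All P (as ++ z ∷ bs) → All P (as ++ bs)
All-++⁻-mid []       (_ ∷ ps) = ps
All-++⁻-mid (a ∷ as) (p ∷ ps) = p ∷ All-++⁻-mid as ps

AllPairs-++⁻-mid : ∀ {R : A → A → Set} as {z bs} → AllPairs R (as ++ z ∷ bs) → AllPairs R (as ++ bs)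
AllPairs-++⁻-mid []       (_ ∷ ps) = ps
AllPairs-++⁻-mid (a ∷ as) (p ∷ ps) = All-++⁻-mid as p ∷ AllPairs-++⁻-mid as ps

AllPairs-++⁻ˡ : ∀ {R : A → A → Set} as {bs} → AllPairs R (as ++ bs) → AllPairs R as
AllPairs-++⁻ˡ []       _        = []
AllPairs-++⁻ˡ (a ∷ as) (p ∷ ps) = ++⁻ˡ as p ∷ AllPairs-++⁻ˡ as ps

AllPairs-++⁻ʳ : ∀ {R : A → A → Set} as {bs} → AllPairs R (as ++ bs) → AllPairs R bs
AllPairs-++⁻ʳ []       ps       = ps
AllPairs-++⁻ʳ (a ∷ as) (_ ∷ ps) = AllPairs-++⁻ʳ as ps

AllPairs-mid : ∀ {R : A → A → Set} as {z bs} → AllPairs R (as ++ z ∷ bs) →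
               ∀ {w} → w ∈ as ++ bs → R w z ⊎ R z w
AllPairs-mid []       (p ∷ _)  w∈         = inj₂ (All.lookup p w∈)
AllPairs-mid (a ∷ as) (p ∷ _)  (here refl) = inj₁ (All.lookup p (∈-++⁺ʳ as (here refl)))
AllPairs-mid (a ∷ as) (_ ∷ ps) (there w∈) = AllPairs-mid as ps w∈

Unique-mid : ∀ (as : List A) {z bs} → Unique (as ++ z ∷ bs) → z ∉ as ++ bs
Unique-mid as u z∈ with AllPairs-mid as u z∈
... | inj₁ z≢z = z≢z refl
... | inj₂ z≢z = z≢z refl

infix 4 _⊑_
_⊑_ : List (Fin n) → List (Fin n) → Set
ws ⊑ ws' = ∀ {p q} → Consec ws p q → Consec ws' p q

Linked⇒Consec : ∀ {J : Fin n → Fin n → Set} {ws p q} → Linked J ws → Consec ws p q → J p q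
Linked⇒Consec {ws = x ∷ y ∷ ws} (j ∷ l) (inj₁ (refl , refl)) = j
Linked⇒Consec {ws = x ∷ y ∷ ws} (j ∷ l) (inj₂ c)             = Linked⇒Consec l c

Consec⇒Linked : ∀ {J : Fin n → Fin n → Set} ws → (∀ {p q} → Consec ws p q → J p q) → Linked J ws
Consec⇒Linked []           f = []
Consec⇒Linked (x ∷ [])     f = [-]
Consec⇒Linked (x ∷ y ∷ ws) f = f (inj₁ (refl , refl)) ∷ Consec⇒Linked (y ∷ ws) (f ∘ inj₂)

Linked-⊑ : ∀ {J : Fin n → Fin n → Set} {ws ws'} → ws ⊑ ws' → Linked J ws' → Linked J ws
Linked-⊑ {ws = ws} sub l = Consec⇒Linked ws (λ c → Linked⇒Consec l (sub c))

consec-∈₁ : ∀ {ws : List (Fin n)} {p q} → Consec ws p q → p ∈ ws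
consec-∈₁ {ws = x ∷ y ∷ ws} (inj₁ (refl , refl)) = here refl
consec-∈₁ {ws = x ∷ y ∷ ws} (inj₂ c)             = there (consec-∈₁ c)

consec-∈₂ : ∀ {ws : List (Fin n)} {p q} → Consec ws p q → q ∈ ws
consec-∈₂ {ws = x ∷ y ∷ ws} (inj₁ (refl , refl)) = there (here refl)
consec-∈₂ {ws = x ∷ y ∷ ws} (inj₂ c)             = there (consec-∈₂ c)

⊑-++ʳ : ∀ (as : List (Fin n)) {bs} → bs ⊑ as ++ bs
⊑-++ʳ []                     c = c
⊑-++ʳ (a ∷ [])     {_ ∷ _}   c = inj₂ c
⊑-++ʳ (a ∷ a' ∷ as)          c = inj₂ (⊑-++ʳ (a' ∷ as) c)

⊑-++ˡ : ∀ (as : List (Fin n)) {bs} → as ⊑ as ++ bs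
⊑-++ˡ (a ∷ a' ∷ as) (inj₁ e) = inj₁ e
⊑-++ˡ (a ∷ a' ∷ as) (inj₂ c) = inj₂ (⊑-++ˡ (a' ∷ as) c)

⊑-snoc : ∀ (as : List (Fin n)) x bs → as ++ [ x ] ⊑ as ++ x ∷ bs
⊑-snoc as x bs c = subst (λ ws → Consec ws _ _) (++-assoc as [ x ] bs) (⊑-++ˡ (as ++ [ x ]) c)

consec-++ : ∀ (as : List (Fin n)) {p q} bs → Consec (as ++ p ∷ q ∷ bs) p q
consec-++ as bs = ⊑-++ʳ as (inj₁ (refl , refl))

consec-∃++ : ∀ {ws : List (Fin n)} {p q} → Consec ws p q → ∃ λ as → ∃ λ bs → ws ≡ as ++ p ∷ q ∷ bs
consec-∃++ {ws = x ∷ y ∷ ws} (inj₁ (refl , refl)) = [] , ws , refl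
consec-∃++ {ws = x ∷ y ∷ ws} (inj₂ c) with as , bs , eq ← consec-∃++ c = x ∷ as , bs , cong (x ∷_) eq

consec-split : ∀ (as : List (Fin n)) x bs {p q} → Consec (as ++ x ∷ bs) p q →
               Consec (as ++ [ x ]) p q ⊎ Consec (x ∷ bs) p q
consec-split []            x bs c        = inj₂ c
consec-split (a ∷ [])      x bs (inj₁ e) = inj₁ (inj₁ e)
consec-split (a ∷ [])      x bs (inj₂ c) = inj₂ c
consec-split (a ∷ a' ∷ as) x bs (inj₁ e) = inj₁ (inj₁ e)
consec-split (a ∷ a' ∷ as) x bs (inj₂ c) with consec-split (a' ∷ as) x bs c
... | inj₁ c' = inj₁ (inj₂ c')
... | inj₂ c' = inj₂ c'

Linked-++ : ∀ {J : Fin n → Fin n → Set} as x bs →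
            Linked J (as ++ [ x ]) → Linked J (x ∷ bs) → Linked J (as ++ x ∷ bs)
Linked-++ {J = J} as x bs l₁ l₂ = Consec⇒Linked (as ++ x ∷ bs) step
  where
  step : ∀ {p q} → Consec (as ++ x ∷ bs) p q → J p q
  step c with consec-split as x bs c
  ... | inj₁ c' = Linked⇒Consec l₁ c'
  ... | inj₂ c' = Linked⇒Consec l₂ c'

NonNegOn : Network n → (Fin n → Fin n → Set) → Set
NonNegOn H J = ∀ {p q} → J p q → 0ℚ ≤ℚ len H p q

Ends-suffix : ∀ {u v : Fin n} as x bs → Ends u v (as ++ x ∷ bs) → Ends x v (x ∷ bs)
Ends-suffix []       x bs (_ , e) = refl , e
Ends-suffix (a ∷ as) x bs (_ , e) = refl , trans (sym (lastOr-++ a as x bs)) e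

path-suffix : ∀ {J : Fin n → Fin n → Set} {u v} as {x bs} → IsPath J u v (as ++ x ∷ bs) → IsPath J x v (x ∷ bs)
path-suffix as (e , u , l) = Ends-suffix as _ _ e , AllPairs-++⁻ʳ as u , Linked-⊑ (⊑-++ʳ as) l

pathLen-++ : ∀ (H : Network n) as x bs →
             pathLen H (as ++ x ∷ bs) ≡ pathLen H (as ++ [ x ]) +ℚ pathLen H (x ∷ bs)
pathLen-++ H []            x bs = sym (ℚ.+-identityˡ _)
pathLen-++ H (a ∷ [])      x bs = cong (_+ℚ pathLen H (x ∷ bs)) (sym (ℚ.+-identityʳ (len H a x)))
pathLen-++ H (a ∷ a' ∷ as) x bs =
  trans (cong (len H a a' +ℚ_) (pathLen-++ H (a' ∷ as) x bs)) (sym (ℚ.+-assoc (len H a a') _ _))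

pathLen-nonneg : ∀ {H : Network n} {J ws} → NonNegOn H J → Linked J ws → 0ℚ ≤ℚ pathLen H ws
pathLen-nonneg nn []      = ℚ.≤-refl
pathLen-nonneg nn [-]     = ℚ.≤-refl
pathLen-nonneg nn (j ∷ l) = ℚ.≤-trans (pathLen-nonneg nn l) (x≤y+x (nn j))

pathLen-suffix : ∀ {H : Network n} {J} as x bs → NonNegOn H J → Linked J (as ++ x ∷ bs) →
                 pathLen H (x ∷ bs) ≤ℚ pathLen H (as ++ x ∷ bs)
pathLen-suffix {H = H} as x bs nn l =
  subst (pathLen H (x ∷ bs) ≤ℚ_) (sym (pathLen-++ H as x bs))
        (x≤y+x (pathLen-nonneg nn (Linked-⊑ (⊑-snoc as x bs) l)))

Shorter : (Fin n → Fin n → Set) → List (Fin n) → List (Fin n) → Set₁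
Shorter {n} J ws ws' = ∀ (H : Network n) → NonNegOn H J → pathLen H ws ≤ℚ pathLen H ws'

walk⇒path : ∀ {J : Fin n → Fin n → Set} x xs → Linked J (x ∷ xs) →
            ∃ λ ws → IsPath J x (lastOr x xs) (x ∷ ws) × x ∷ ws ⊑ x ∷ xs × Shorter J (x ∷ ws) (x ∷ xs)
walk⇒path x []       _       = [] , ((refl , refl) , [] ∷ [] , [-]) , id , λ _ _ → ℚ.≤-refl
walk⇒path x (y ∷ ys) (j ∷ l) with walk⇒path y ys l
... | ws , P , sub , short with x ≟ y | x ∈? ws
...   | yes refl | _      = ws , P , inj₂ ∘ sub , λ H nn → ℚ.≤-trans (short H nn) (x≤y+x (nn j))
...   | no _     | yes x∈ with as , bs , refl ← ∈-∃++ x∈ =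
  bs , path-suffix (y ∷ as) P , inj₂ ∘ sub ∘ ⊑-++ʳ (y ∷ as) ,
  λ H nn → ℚ.≤-trans (pathLen-suffix (y ∷ as) x bs nn (proj₂ (proj₂ P)))
                     (ℚ.≤-trans (short H nn) (x≤y+x (nn j)))
...   | no x≢y   | no x∉ =
  y ∷ ws , ((refl , proj₂ (proj₁ P)) , x∉y∷ws ∷ proj₁ (proj₂ P) , j ∷ proj₂ (proj₂ P)) , sub' ,
  λ H nn → ℚ.+-monoʳ-≤ (len H x y) (short H nn)
  where
  x∉y∷ws : All (x ≢_) (y ∷ ws)
  x∉y∷ws = x≢y ∷ ¬Any⇒All¬ ws x∉
  sub' : x ∷ y ∷ ws ⊑ x ∷ y ∷ ys
  sub' (inj₁ e) = inj₁ e
  sub' (inj₂ c) = inj₂ (sub c)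

consec-reverse : ∀ {ws : List (Fin n)} {p q} → Consec (reverse ws) p q → Consec ws q p
consec-reverse {ws = ws} {p} {q} c with as , bs , eq ← consec-∃++ c =
  subst (λ zs → Consec zs q p) ws≡ (consec-++ (reverse bs) (reverse as))
  where
  open ≡.≡-Reasoning
  ws≡ : reverse bs ++ q ∷ p ∷ reverse as ≡ ws
  ws≡ = begin
    reverse bs ++ q ∷ p ∷ reverse as      ≡⟨ ++-assoc (reverse bs) (q ∷ p ∷ []) (reverse as) ⟨
    (reverse bs ++ q ∷ p ∷ []) ++ reverse as ≡⟨ cong (_++ reverse as) (reverse-++ (p ∷ q ∷ []) bs) ⟨
    reverse (p ∷ q ∷ bs) ++ reverse as     ≡⟨ reverse-++ as (p ∷ q ∷ bs) ⟨
    reverse (as ++ p ∷ q ∷ bs)             ≡⟨ cong reverse eq ⟨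
    reverse (reverse ws)                   ≡⟨ reverse-involutive ws ⟩
    ws                                     ∎

Ends-∷ʳ : ∀ {u v : Fin n} zs x → Ends u v zs → Ends u x (zs ++ [ x ])
Ends-∷ʳ (z ∷ zs) x (e , _) = e , lastOr-++ z zs x []

Ends-reverse : ∀ {u v : Fin n} ws → Ends u v ws → Ends v u (reverse ws)
Ends-reverse (x ∷ [])     (refl , refl) = refl , refl
Ends-reverse (x ∷ y ∷ ys) (refl , e)    =
  subst (Ends _ x) (sym (unfold-reverse x (y ∷ ys)))
        (Ends-∷ʳ (reverse (y ∷ ys)) x (Ends-reverse (y ∷ ys) (refl , e)))

Unique-reverse : ∀ (ws : List A) → Unique ws → Unique (reverse ws)
Unique-reverse {A = A} ws = Unique-resp-↭ (↭⇒↭ₛ (↭-sym (↭-reverse ws)))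
  where open PermutationSetoid (≡.setoid A) using (Unique-resp-↭)

path-reverse : ∀ {J : Fin n → Fin n → Set} → (∀ {p q} → J p q → J q p) →
               ∀ {u v ws} → IsPath J u v ws → IsPath J v u (reverse ws)
path-reverse J-sym {ws = ws} (e , u , l) =
  Ends-reverse ws e , Unique-reverse ws u , Consec⇒Linked (reverse ws) (J-sym ∘ Linked⇒Consec l ∘ consec-reverse)

pathLen-reverse : ∀ (H : Network n) ws → (∀ {p q} → Consec ws p q → len H p q ≡ len H q p) →
                  pathLen H (reverse ws) ≡ pathLen H ws
pathLen-reverse H []           sym-len = refl
pathLen-reverse H (x ∷ [])     sym-len = refl
pathLen-reverse H (x ∷ y ∷ ys) sym-len
  with IH ← pathLen-reverse H (y ∷ ys) (sym-len ∘ inj₂) = begin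
  pathLen H (reverse (x ∷ y ∷ ys))                       ≡⟨ cong (pathLen H) reverse≡ ⟩
  pathLen H (reverse ys ++ y ∷ x ∷ [])                   ≡⟨ pathLen-++ H (reverse ys) y (x ∷ []) ⟩
  pathLen H (reverse ys ++ [ y ]) +ℚ (len H y x +ℚ 0ℚ)     ≡⟨ cong₂ _+ℚ_ reverse-tail (ℚ.+-identityʳ (len H y x)) ⟩
  pathLen H (y ∷ ys) +ℚ len H y x                         ≡⟨ ℚ.+-comm _ (len H y x) ⟩
  len H y x +ℚ pathLen H (y ∷ ys)                         ≡⟨ cong (_+ℚ pathLen H (y ∷ ys)) (sym-len (inj₁ (refl , refl))) ⟨
  len H x y +ℚ pathLen H (y ∷ ys)                         ∎
  where
  open ≡.≡-Reasoning
  reverse≡ : reverse (x ∷ y ∷ ys) ≡ reverse ys ++ y ∷ x ∷ []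
  reverse≡ = trans (unfold-reverse x (y ∷ ys))
                   (trans (cong (_++ [ x ]) (unfold-reverse y ys)) (++-assoc (reverse ys) [ y ] [ x ]))
  reverse-tail : pathLen H (reverse ys ++ [ y ]) ≡ pathLen H (y ∷ ys)
  reverse-tail = trans (cong (pathLen H) (sym (unfold-reverse y ys))) IH

-- Edges and bypassing a vertex

Inc : Fin n → Edge n → Set
Inc v e = proj₁ e ≡ v ⊎ proj₂ e ≡ v

Inc? : (v : Fin n) (e : Edge n) → Dec (Inc v e)
Inc? v e = (proj₁ e ≟ v) ⊎-dec (proj₂ e ≟ v)

SameEdge? : (e f : Edge n) → Dec (SameEdge e f)
SameEdge? (u , v) (u' , v') = ((u ≟ u') ×-dec (v ≟ v')) ⊎-dec ((u ≟ v') ×-dec (v ≟ u'))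

SameEdge-sym : ∀ {e f : Edge n} → SameEdge e f → SameEdge f e
SameEdge-sym (inj₁ (refl , refl)) = inj₁ (refl , refl)
SameEdge-sym (inj₂ (refl , refl)) = inj₂ (refl , refl)

SameEdge-trans : ∀ {e f g : Edge n} → SameEdge e f → SameEdge f g → SameEdge e g
SameEdge-trans (inj₁ (refl , refl)) s                    = s
SameEdge-trans (inj₂ (refl , refl)) (inj₁ (refl , refl)) = inj₂ (refl , refl)
SameEdge-trans (inj₂ (refl , refl)) (inj₂ (refl , refl)) = inj₁ (refl , refl)

SameEdge-flip : ∀ {e : Edge n} {x y} → SameEdge e (x , y) → SameEdge e (y , x)
SameEdge-flip (inj₁ (refl , refl)) = inj₂ (refl , refl)
SameEdge-flip (inj₂ (refl , refl)) = inj₁ (refl , refl)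

SameEdge⇒Inc : ∀ {e : Edge n} {x y} → SameEdge e (x , y) → Inc y e
SameEdge⇒Inc (inj₁ (refl , refl)) = inj₂ refl
SameEdge⇒Inc (inj₂ (refl , refl)) = inj₁ refl

Inc-SameEdge : ∀ {e : Edge n} {x y v} → SameEdge e (x , y) → Inc v e → x ≡ v ⊎ y ≡ v
Inc-SameEdge (inj₁ (refl , refl)) i          = i
Inc-SameEdge (inj₂ (refl , refl)) (inj₁ eq) = inj₂ eq
Inc-SameEdge (inj₂ (refl , refl)) (inj₂ eq) = inj₁ eq

SameEdge-≢ : ∀ {e : Edge n} {x y} → SameEdge e (x , y) → proj₁ e ≢ proj₂ e → x ≢ y
SameEdge-≢ (inj₁ (refl , refl)) ne = ne
SameEdge-≢ (inj₂ (refl , refl)) ne = ne ∘ sym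

otherEnd : ∀ {v} {e : Edge n} → Inc v e → ∃ λ a → SameEdge e (a , v)
otherEnd {e = x , y} (inj₁ refl) = y , inj₂ (refl , refl)
otherEnd {e = x , y} (inj₂ refl) = x , inj₁ (refl , refl)

EdgeIn-sym : ∀ {E : List (Edge n)} {u v} → EdgeIn E u v → EdgeIn E v u
EdgeIn-sym (e , e∈ , s) = e , e∈ , SameEdge-flip s

EdgeIn-⊆ : ∀ {E E' : List (Edge n)} → E ⊆ E' → ∀ {u v} → EdgeIn E u v → EdgeIn E' u v
EdgeIn-⊆ sub (e , e∈ , s) = e , sub e∈ , s

EdgeIn-≢ : ∀ {E : List (Edge n)} → All (λ e → proj₁ e ≢ proj₂ e) E → ∀ {u v} → EdgeIn E u v → u ≢ v
EdgeIn-≢ E≢ (e , e∈ , s) = SameEdge-≢ s (All.lookup E≢ e∈)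

IsPath-⊆ : ∀ {E E' : List (Edge n)} → E ⊆ E' → ∀ {u v ws} → IsPath (EdgeIn E) u v ws → IsPath (EdgeIn E') u v ws
IsPath-⊆ sub (e , u , l) = e , u , Linked.map (EdgeIn-⊆ sub) l

ConnIn-⊆ : ∀ {E E' : List (Edge n)} → E ⊆ E' → ∀ {u v} → ConnIn E u v → ConnIn E' u v
ConnIn-⊆ sub (ws , P) = ws , IsPath-⊆ sub P

ConnIn-edge : ∀ {E : List (Edge n)} {u v} → u ≢ v → ConnIn E u v → ∃ (_∈ E)
ConnIn-edge u≢v (x ∷ [] , (refl , refl) , _)                  = ⊥-elim (u≢v refl)
ConnIn-edge u≢v (x ∷ y ∷ ws , _ , _ , (e , e∈ , _) ∷ _) = e , e∈

EdgeIn? : (E : List (Edge n)) (u v : Fin n) → Dec (EdgeIn E u v)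
EdgeIn? E u v with any? (λ e → SameEdge? e (u , v)) E
... | yes found = yes (find found)
... | no ¬found = no λ { (e , e∈ , s) → ¬found (Any.map (λ { refl → s }) e∈) }

interior : ∀ {u w v : Fin n} ws → v ∈ ws → Ends u w ws → u ≢ v → w ≢ v →
           ∃ λ as → ∃ λ x → ∃ λ y → ∃ λ bs → ws ≡ as ++ x ∷ v ∷ y ∷ bs
interior (z ∷ zs) (here refl) (refl , _) u≢v _ = ⊥-elim (u≢v refl)
interior {v = v} (z ∷ z' ∷ zs) (there v∈) (refl , e) u≢v w≢v with z' ≟ v
interior (z ∷ z' ∷ [])     _ (refl , e) _ w≢v | yes refl = ⊥-elim (w≢v (sym e))
interior (z ∷ z' ∷ y ∷ bs) _ _          _ _   | yes refl = [] , z , y , bs , refl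
... | no z'≢v with as , x , y , bs , eq ← interior (z' ∷ zs) v∈ (refl , e) z'≢v w≢v =
  z ∷ as , x , y , bs , cong (z ∷_) eq

Ends-++-∷ : ∀ {u w : Fin n} as x bs bs' → Ends u w (as ++ x ∷ bs) → lastOr x bs ≡ lastOr x bs' →
            Ends u w (as ++ x ∷ bs')
Ends-++-∷ []       x bs bs' (e₁ , e₂) eq = e₁ , trans (sym eq) e₂
Ends-++-∷ (a ∷ as) x bs bs' (e₁ , e₂) eq =
  e₁ , trans (lastOr-++ a as x bs') (trans (sym eq) (trans (sym (lastOr-++ a as x bs)) e₂))

record IsBypass (E : List (Edge n)) (v a b : Fin n) (E' : List (Edge n)) : Set where
  field
    at-v     : ∀ {e} → e ∈ E → Inc v e → SameEdge e (a , v) ⊎ SameEdge e (v , b)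
    away     : ∀ {x y} → EdgeIn E x y → x ≢ v → y ≢ v → EdgeIn E' x y
    shortcut : EdgeIn E a v → EdgeIn E v b → EdgeIn E' a b

  neighbour : ∀ {x} → EdgeIn E x v → x ≢ v → x ≡ a ⊎ x ≡ b
  neighbour (e , e∈ , s) x≢v with at-v e∈ (SameEdge⇒Inc s)
  ... | inj₁ s' with SameEdge-trans (SameEdge-sym s) s'
  ...   | inj₁ (x≡a , _) = inj₁ x≡a
  ...   | inj₂ (x≡v , _) = ⊥-elim (x≢v x≡v)
  neighbour (e , e∈ , s) x≢v | inj₂ s' with SameEdge-trans (SameEdge-sym s) s'
  ...   | inj₁ (x≡v , _) = ⊥-elim (x≢v x≡v)
  ...   | inj₂ (x≡b , _) = inj₂ x≡b

BypassedPath : List (Edge n) → Fin n → Fin n → Fin n → Fin n → Fin n → List (Fin n) → Set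
BypassedPath E' v a b u w ws =
  ∃ λ ws' → IsPath (EdgeIn E') u w ws' ×
            (∀ {p q} → Consec ws p q → p ≢ v → q ≢ v → Consec ws' p q) ×
            (v ∈ ws → Consec ws' a b ⊎ Consec ws' b a)

bypass-interior : ∀ {E E' : List (Edge n)} {v a b u w} → IsBypass E v a b E' →
  ∀ as x y bs → IsPath (EdgeIn E) u w (as ++ x ∷ v ∷ y ∷ bs) → BypassedPath E' v a b u w (as ++ x ∷ v ∷ y ∷ bs)
bypass-interior {E = E} {E'} {v} {a} {b} B as x y bs (e , un , l) =
  ws' , (Ends-++-∷ as x (v ∷ y ∷ bs) (y ∷ bs) e refl , un' , Consec⇒Linked ws' step') , kept , λ _ → proj₁ xy
  where
  open IsBypass B
  ws ws' : List (Fin _)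
  ws  = as ++ x ∷ v ∷ y ∷ bs
  ws' = as ++ x ∷ y ∷ bs
  reassoc : ∀ zs → as ++ x ∷ zs ≡ (as ++ [ x ]) ++ zs
  reassoc zs = sym (++-assoc as [ x ] zs)
  un' : Unique ws'
  un' = subst Unique (++-assoc as [ x ] (y ∷ bs)) (AllPairs-++⁻-mid (as ++ [ x ]) (subst Unique (reassoc _) un))
  v∉ : v ∉ ws'
  v∉ v∈ = Unique-mid (as ++ [ x ]) (subst Unique (reassoc _) un) (subst (v ∈_) (reassoc _) v∈)
  x∉ : x ∉ as ++ v ∷ y ∷ bs
  x∉ = Unique-mid as un
  x≢y : x ≢ y
  x≢y refl = x∉ (∈-++⁺ʳ as (there (here refl)))
  x≢v : x ≢ v
  x≢v refl = x∉ (∈-++⁺ʳ as (here refl))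
  y≢v : y ≢ v
  y≢v refl = v∉ (∈-++⁺ʳ as (there (here refl)))
  xv : EdgeIn E x v
  xv = Linked⇒Consec l (consec-++ as (y ∷ bs))
  vy : EdgeIn E v y
  vy = Linked⇒Consec l (⊑-++ʳ as (inj₂ (inj₁ (refl , refl))))
  xy : (Consec ws' a b ⊎ Consec ws' b a) × EdgeIn E' x y
  xy with neighbour xv x≢v | neighbour (EdgeIn-sym vy) y≢v
  ... | inj₁ refl | inj₁ refl = ⊥-elim (x≢y refl)
  ... | inj₁ refl | inj₂ refl = inj₁ (consec-++ as bs) , shortcut xv vy
  ... | inj₂ refl | inj₁ refl = inj₂ (consec-++ as bs) , EdgeIn-sym (shortcut (EdgeIn-sym vy) (EdgeIn-sym xv))
  ... | inj₂ refl | inj₂ refl = ⊥-elim (x≢y refl)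
  step' : ∀ {p q} → Consec ws' p q → EdgeIn E' p q
  step' c with consec-split as x (y ∷ bs) c
  ... | inj₂ (inj₁ (refl , refl)) = proj₂ xy
  ... | inj₁ c' = away (Linked⇒Consec l (⊑-snoc as x (v ∷ y ∷ bs) c'))
                       (λ { refl → v∉ (consec-∈₁ c) }) (λ { refl → v∉ (consec-∈₂ c) })
  ... | inj₂ (inj₂ c') = away (Linked⇒Consec l (⊑-++ʳ as (inj₂ (inj₂ c'))))
                              (λ { refl → v∉ (consec-∈₁ c) }) (λ { refl → v∉ (consec-∈₂ c) })
  kept : ∀ {p q} → Consec ws p q → p ≢ v → q ≢ v → Consec ws' p q
  kept c p≢v q≢v with consec-split as x (v ∷ y ∷ bs) c
  ... | inj₁ c'                      = ⊑-snoc as x (y ∷ bs) c'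
  ... | inj₂ (inj₁ (_ , q≡v))        = ⊥-elim (q≢v q≡v)
  ... | inj₂ (inj₂ (inj₁ (p≡v , _))) = ⊥-elim (p≢v p≡v)
  ... | inj₂ (inj₂ (inj₂ c'))        = ⊑-++ʳ as (inj₂ c')

bypass-path : ∀ {E E' : List (Edge n)} {v a b u w ws} → IsBypass E v a b E' → u ≢ v → w ≢ v →
              IsPath (EdgeIn E) u w ws → BypassedPath E' v a b u w ws
bypass-path {v = v} {ws = ws} B u≢v w≢v P@(e , un , l) with v ∈? ws
... | yes v∈ with as , x , y , bs , refl ← interior ws v∈ e u≢v w≢v = bypass-interior B as x y bs P
... | no v∉ = ws , (e , un , Consec⇒Linked ws step) , (λ c _ _ → c) , ⊥-elim ∘ v∉
  where
  step : ∀ {p q} → Consec ws p q → EdgeIn _ p q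
  step c = IsBypass.away B (Linked⇒Consec l c) (λ { refl → v∉ (consec-∈₁ c) }) (λ { refl → v∉ (consec-∈₂ c) })

ConnIn-bypass : ∀ {E E' : List (Edge n)} {v a b u w} → IsBypass E v a b E' → u ≢ v → w ≢ v →
                ConnIn E u w → ConnIn E' u w
ConnIn-bypass B u≢v w≢v (ws , P) = proj₁ (bypass-path B u≢v w≢v P) , proj₁ (proj₂ (bypass-path B u≢v w≢v P))

Linked-∷ʳ⁺ : ∀ {J : Fin n → Fin n → Set} {x xs y} → Linked J (x ∷ xs) → J (lastOr x xs) y → Linked J (x ∷ xs ++ [ y ])
Linked-∷ʳ⁺ {xs = []}    [-]      j = j ∷ [-]
Linked-∷ʳ⁺ {xs = _ ∷ _} (j' ∷ l) j = j' ∷ Linked-∷ʳ⁺ l j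

Linked-∷ʳ⁻ : ∀ {J : Fin n → Fin n → Set} {x xs y} → Linked J (x ∷ xs ++ [ y ]) → Linked J (x ∷ xs) × J (lastOr x xs) y
Linked-∷ʳ⁻ {xs = []}    (j ∷ [-]) = [-] , j
Linked-∷ʳ⁻ {xs = _ ∷ _} (j' ∷ l) with l' , j ← Linked-∷ʳ⁻ l = j' ∷ l' , j

consec-≢-last : ∀ {x : Fin n} {xs p q} → Unique (x ∷ xs) → Consec (x ∷ xs) p q → p ≢ lastOr x xs
consec-≢-last {xs = y ∷ ys} (x∉ ∷ _) (inj₁ (refl , refl)) = All.lookup x∉ (lastOr-∈ y ys)
consec-≢-last {xs = y ∷ ys} (_ ∷ un) (inj₂ c)             = consec-≢-last un c

¬consec-first-last : ∀ {x : Fin n} {xs} → Unique (x ∷ xs) → 2 ≤ length xs → ¬ Consec (x ∷ xs) x (lastOr x xs)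
¬consec-first-last {xs = y ∷ []}     _            (s≤s ())
¬consec-first-last {xs = y ∷ z ∷ zs} (_ ∷ y∉ ∷ _) _ (inj₁ (_ , l≡y)) = All.lookup y∉ (lastOr-∈ z zs) (sym l≡y)
¬consec-first-last {xs = y ∷ z ∷ zs} (x∉ ∷ _)     _ (inj₂ c)         = All.lookup x∉ (consec-∈₁ c) refl

x≢last : ∀ {x : Fin n} {xs} → Unique (x ∷ xs) → 1 ≤ length xs → x ≢ lastOr x xs
x≢last {xs = y ∷ ys} (x∉ ∷ _) _ = All.lookup x∉ (lastOr-∈ y ys)

consec-from : ∀ {w z : Fin n} ws → w ∈ ws → ∃ λ q → Consec (ws ++ [ z ]) w q
consec-from (y ∷ [])      (here refl) = _ , inj₁ (refl , refl)
consec-from (y ∷ [])      (there ())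
consec-from (y ∷ y' ∷ ys) (here refl) = y' , inj₁ (refl , refl)
consec-from (y ∷ y' ∷ ys) (there w∈) with q , c ← consec-from (y' ∷ ys) w∈ = q , inj₂ c

module _ {F F' : List (Edge n)} {v a b : Fin n} (av : EdgeIn F a v) (vb : EdgeIn F v b)
         (old : ∀ {p q} → EdgeIn F' p q → SameEdge (a , b) (p , q) ⊎ EdgeIn F p q) where

  via-v : ∀ {p q} → SameEdge (a , b) (p , q) → EdgeIn F p v × EdgeIn F v q
  via-v (inj₁ (refl , refl)) = av , vb
  via-v (inj₂ (refl , refl)) = EdgeIn-sym vb , EdgeIn-sym av

  expand-walk : ∀ x xs → Linked (EdgeIn F') (x ∷ xs) →
    ∃ λ ys → Linked (EdgeIn F) (x ∷ ys) × lastOr x ys ≡ lastOr x xs ×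
             (∀ {p q} → Consec (x ∷ ys) p q → Consec (x ∷ xs) p q ⊎ (p ≡ v ⊎ q ≡ v))
  expand-walk x []       [-]     = [] , [-] , refl , λ ()
  expand-walk x (y ∷ xs) (e ∷ l) with ys , l' , last , steps ← expand-walk y xs l | old e
  ... | inj₂ eF = y ∷ ys , eF ∷ l' , last , steps'
    where
    steps' : ∀ {p q} → Consec (x ∷ y ∷ ys) p q → Consec (x ∷ y ∷ xs) p q ⊎ (p ≡ v ⊎ q ≡ v)
    steps' (inj₁ eq) = inj₁ (inj₁ eq)
    steps' (inj₂ c)  = Data.Sum.map₁ inj₂ (steps c)
  ... | inj₁ ab≈xy = v ∷ y ∷ ys , proj₁ (via-v ab≈xy) ∷ proj₂ (via-v ab≈xy) ∷ l' , last , steps'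
    where
    steps' : ∀ {p q} → Consec (x ∷ v ∷ y ∷ ys) p q → Consec (x ∷ y ∷ xs) p q ⊎ (p ≡ v ⊎ q ≡ v)
    steps' (inj₁ (_ , q≡v))        = inj₂ (inj₂ q≡v)
    steps' (inj₂ (inj₁ (p≡v , _))) = inj₂ (inj₁ p≡v)
    steps' (inj₂ (inj₂ c))         = Data.Sum.map₁ inj₂ (steps c)

  avoids-v : (∀ {p q} → EdgeIn F' p q → p ≢ v) → ∀ {x xs} → Linked (EdgeIn F') (x ∷ xs ++ [ x ]) → v ∉ x ∷ xs
  avoids-v avoid {x} {xs} cyc v∈ with q , c ← consec-from (x ∷ xs) v∈ = avoid (Linked⇒Consec cyc c) refl

  -- A cycle of F' closing along a–b becomes a cycle of F through v; any other cycle of F'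
  -- expands to a closed walk of F that still contains a cycle.
  Acyclic-bypass : Acyclic F → (∀ {p q} → EdgeIn F' p q → p ≢ v) → Acyclic F'
  Acyclic-bypass acyclic avoid x xs (2≤len , un , cyc) with Linked-∷ʳ⁻ cyc
  ... | path , closing with old closing
  ...   | inj₁ ab≈lx =
    acyclic v (x ∷ xs) (ℕ.m≤n⇒m≤1+n 2≤len , ¬Any⇒All¬ (x ∷ xs) (avoids-v avoid cyc) ∷ un ,
                        proj₂ (via-v ab≈lx) ∷ Linked-∷ʳ⁺ pathF (proj₁ (via-v ab≈lx)))
    where
    pathF : Linked (EdgeIn F) (x ∷ xs)
    pathF = Consec⇒Linked (x ∷ xs) step
      where
      step : ∀ {p q} → Consec (x ∷ xs) p q → EdgeIn F p q
      step c with old (Linked⇒Consec path c)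
      ... | inj₂ eF = eF
      ... | inj₁ ab≈pq with SameEdge-trans (SameEdge-sym ab≈pq) ab≈lx
      ...   | inj₁ (refl , refl) = ⊥-elim (consec-≢-last un c refl)
      ...   | inj₂ (refl , refl) = ⊥-elim (¬consec-first-last un 2≤len c)
  ...   | inj₂ closingF with expand-walk x xs path
  ...     | ys , walk , last , steps with walk⇒path x ys walk
  ...       | qs , Q , sub , _ = cycle qs Q sub
    where
    v∉ : v ∉ x ∷ xs
    v∉ = avoids-v avoid cyc
    x≢l : x ≢ lastOr x xs
    x≢l = x≢last un (ℕ.<⇒≤ 2≤len)
    cycle : ∀ qs → IsPath (EdgeIn F) x (lastOr x ys) (x ∷ qs) → x ∷ qs ⊑ x ∷ ys → ⊥
    cycle []       ((_ , x≡l) , _) _   = x≢l (trans x≡l last)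
    cycle (q ∷ []) ((_ , q≡l) , _) sub with steps (sub (inj₁ (refl , refl)))
    ... | inj₁ c          = ¬consec-first-last un 2≤len (subst (Consec (x ∷ xs) x) (trans q≡l last) c)
    ... | inj₂ (inj₁ x≡v) = v∉ (subst (_∈ x ∷ xs) x≡v (here refl))
    ... | inj₂ (inj₂ q≡v) = v∉ (subst (_∈ x ∷ xs) (trans (sym (trans q≡l last)) q≡v) (lastOr-∈ x xs))
    cycle (q ∷ q' ∷ qs) ((_ , ends) , unQ , linkQ) _ =
      acyclic x (q ∷ q' ∷ qs) (s≤s (s≤s z≤n) , unQ ,
                               Linked-∷ʳ⁺ linkQ (subst (λ z → EdgeIn F z x) (sym (trans ends last)) closingF))

-- r-forests of the metric closure

Acyclic-⊆ : ∀ {E E' : List (Edge n)} → E ⊆ E' → Acyclic E' → Acyclic E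
Acyclic-⊆ sub acyclic x xs (len , un , l) = acyclic x xs (len , un , Linked.map (EdgeIn-⊆ sub) l)

AllPairs-resp-↭ : ∀ {R : A → A → Set} → (∀ {x y} → R x y → R y x) →
                  ∀ {xs ys} → xs ↭ ys → AllPairs R xs → AllPairs R ys
AllPairs-resp-↭ {A = A} {R} R-sym p = PermutationSetoid.AllPairs-resp-↭ (≡.setoid A) R-sym (≡.resp₂ R) (↭⇒↭ₛ p)

IsRForest-resp-↭ : ∀ {H : Network n} {R : Fin r → Edge n} {σ τ} → σ ↭ τ → IsRForest H R σ → IsRForest H R τ
IsRForest-resp-↭ {σ = σ} {τ} σ↭τ ((adj , distinct) , acyclic , connects , onPath) =
  (All-resp-↭ σ↭τ adj , AllPairs-resp-↭ (_∘ SameEdge-sym) σ↭τ distinct) ,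
  Acyclic-⊆ τ⊆σ acyclic ,
  (λ i → ConnIn-⊆ σ⊆τ (connects i)) ,
  λ e e∈ → let i , ws , P , on = onPath e (τ⊆σ e∈) in i , ws , IsPath-⊆ σ⊆τ P , on
  where
  σ⊆τ : σ ⊆ τ
  σ⊆τ = ∈-resp-↭ σ↭τ
  τ⊆σ : τ ⊆ σ
  τ⊆σ = ∈-resp-↭ (↭-sym σ↭τ)

IsRForest-closure : ∀ {G : Network n} {R : Fin r → Edge n} {F} → (∀ u → ¬ Adj G u u) →
                    (d : Fin n → Fin n → ℚ) → IsRForest G R F → IsRForest (closure d) R F
IsRForest-closure {G = G} irreflexive d ((adj , distinct) , rest) =
  (All.map (λ {e} a e≡ → irreflexive (proj₁ e) (subst (Adj G (proj₁ e)) (sym e≡) a)) adj , distinct) , rest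

endpoints : Edge n → List (Fin n)
endpoints e = proj₁ e ∷ proj₂ e ∷ []

terminal₁ : ∀ (R : Fin r → Edge n) i → proj₁ (R i) ∈ terminals R
terminal₁ R i = ∈-concatMap⁺ (endpoints ∘ R) (Any.map (λ { refl → here refl }) (∈-allFin i))

terminal₂ : ∀ (R : Fin r → Edge n) i → proj₂ (R i) ∈ terminals R
terminal₂ R i = ∈-concatMap⁺ (endpoints ∘ R) (Any.map (λ { refl → there (here refl) }) (∈-allFin i))

∉terminals : ∀ {R : Fin r → Edge n} {v} → v ∉ terminals R → ∀ i → proj₁ (R i) ≢ v × proj₂ (R i) ≢ v
∉terminals {R = R} v∉ i = (λ { refl → v∉ (terminal₁ R i) }) , (λ { refl → v∉ (terminal₂ R i) })

∈forestVertices⁻ : ∀ {v : Fin n} σ → v ∈ forestVertices σ → ∃ λ e → e ∈ σ × Inc v e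
∈forestVertices⁻ σ v∈ with find (∈-concatMap⁻ endpoints {xs = σ} v∈)
... | e , e∈ , here eq         = e , e∈ , inj₁ (sym eq)
... | e , e∈ , there (here eq) = e , e∈ , inj₂ (sym eq)

∈forestVertices⁺ : ∀ {v : Fin n} {σ e} → e ∈ σ → Inc v e → v ∈ forestVertices σ
∈forestVertices⁺ e∈ (inj₁ refl) = ∈-concatMap⁺ endpoints (Any.map (λ { refl → here refl }) e∈)
∈forestVertices⁺ e∈ (inj₂ refl) = ∈-concatMap⁺ endpoints (Any.map (λ { refl → there (here refl) }) e∈)

NonTerminal : (Fin r → Edge n) → List (Edge n) → Fin n → Set
NonTerminal R σ v = v ∈ forestVertices σ × v ∉ terminals R

deg : Fin n → List (Edge n) → ℕ
deg v σ = length (filter (Inc? v) σ)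

Branching : (Fin r → Edge n) → List (Edge n) → Set
Branching R σ = ∀ v → NonTerminal R σ v → 3 ≤ deg v σ

2≤length-filter : ∀ {P : A → Set} (P? : Decidable P) {xs x y} → x ∈ xs → y ∈ xs → x ≢ y → P x → P y →
                  2 ≤ length (filter P? xs)
2≤length-filter {A = A} P? x∈ y∈ x≢y px py = two (∈-filter⁺ P? x∈ px) (∈-filter⁺ P? y∈ py) x≢y
  where
  two : ∀ {ys : List A} {x y} → x ∈ ys → y ∈ ys → x ≢ y → 2 ≤ length ys
  two (here refl) (here refl)     x≢y = ⊥-elim (x≢y refl)
  two (here refl) (there {xs = _ ∷ _} _) _ = s≤s (s≤s z≤n)
  two (there {xs = _ ∷ _} _) (here refl) _ = s≤s (s≤s z≤n)
  two (there x∈) (there y∈) x≢y = ℕ.m≤n⇒m≤1+n (two x∈ y∈ x≢y)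

EdgeOnPath-Inc : ∀ {e : Edge n} {ws x y v} → Consec ws x y → SameEdge e (x , y) → Inc v e → v ∈ ws
EdgeOnPath-Inc c s i with Inc-SameEdge s i
... | inj₁ refl = consec-∈₁ c
... | inj₂ refl = consec-∈₂ c

-- A non-terminal vertex lies strictly inside the path of some relevant pair.
2≤deg : ∀ {H : Network n} {R : Fin r → Edge n} {σ v} → IsRForest H R σ → NonTerminal R σ v → 2 ≤ deg v σ
2≤deg {v = v} (_ , _ , _ , onPath) (v∈ , v∉T)
  with e , e∈ , inc ← ∈forestVertices⁻ _ v∈
  with i , ws , (ends , un , l) , (x , y , c , s) ← onPath e e∈
  with as , x' , y' , bs , refl ← interior ws (EdgeOnPath-Inc c s inc) ends (proj₁ (∉terminals v∉T i)) (proj₂ (∉terminals v∉T i))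
  with e₁ , e₁∈ , s₁ ← Linked⇒Consec l (consec-++ as (y' ∷ bs))
  with e₂ , e₂∈ , s₂ ← Linked⇒Consec l (⊑-++ʳ as (inj₂ (inj₁ (refl , refl))))
  = 2≤length-filter (Inc? v) e₁∈ e₂∈ e₁≢e₂ (SameEdge⇒Inc s₁) (SameEdge⇒Inc (SameEdge-flip s₂))
  where
  e₁≢e₂ : e₁ ≢ e₂
  e₁≢e₂ refl with SameEdge-trans (SameEdge-sym s₁) s₂
  ... | inj₁ (x'≡v , _) = Unique-mid as un (∈-++⁺ʳ as (here x'≡v))
  ... | inj₂ (x'≡y' , _) = Unique-mid as un (∈-++⁺ʳ as (there (here x'≡y')))

module _ {P : A → Set} (P? : Decidable P) where

  filter-first : ∀ xs → All (¬_ ∘ P) xs ⊎ ∃ λ as → ∃ λ x → ∃ λ bs → xs ≡ as ++ x ∷ bs × All (¬_ ∘ P) as × P x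
  filter-first []       = inj₁ []
  filter-first (y ∷ xs) with P? y | filter-first xs
  ... | yes py | _        = inj₂ ([] , y , xs , refl , [] , py)
  ... | no ¬py | inj₁ all = inj₁ (¬py ∷ all)
  ... | no ¬py | inj₂ (as , x , bs , refl , all , px) = inj₂ (y ∷ as , x , bs , refl , ¬py ∷ all , px)

  length-filter-first : ∀ as {x} bs → All (¬_ ∘ P) as → P x → length (filter P? (as ++ x ∷ bs)) ≡ suc (length (filter P? bs))
  length-filter-first as bs none px = begin
    length (filter P? (as ++ _ ∷ bs))              ≡⟨ cong length (filter-++ P? as (_ ∷ bs)) ⟩
    length (filter P? as ++ filter P? (_ ∷ bs))    ≡⟨ cong (λ zs → length (zs ++ filter P? (_ ∷ bs))) (filter-none P? none) ⟩
    length (filter P? (_ ∷ bs))                    ≡⟨ cong length (filter-accept P? px) ⟩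
    suc (length (filter P? bs))                    ∎
    where open ≡.≡-Reasoning

  length-filter≡0 : ∀ xs → length (filter P? xs) ≡ 0 → All (¬_ ∘ P) xs
  length-filter≡0 xs eq with filter-first xs
  ... | inj₁ none = none
  ... | inj₂ (as , x , bs , refl , none , px) with () ← trans (sym (length-filter-first as bs none px)) eq

  filter-two : ∀ xs → length (filter P? xs) ≡ 2 →
               ∃ λ p → ∃ λ e₁ → ∃ λ q → ∃ λ e₂ → ∃ λ s → xs ≡ p ++ e₁ ∷ q ++ e₂ ∷ s ×
               All (¬_ ∘ P) p × All (¬_ ∘ P) q × All (¬_ ∘ P) s × P e₁ × P e₂
  filter-two xs eq with filter-first xs
  ... | inj₁ none with () ← trans (sym (cong length (filter-none P? none))) eq
  ... | inj₂ (p , e₁ , ys , refl , none-p , pe₁) with filter-first ys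
  ...   | inj₁ none with () ← trans (sym (trans (length-filter-first p ys none-p pe₁) (cong (suc ∘ length) (filter-none P? none)))) eq
  ...   | inj₂ (q , e₂ , s , refl , none-q , pe₂) =
    p , e₁ , q , e₂ , s , refl , none-p , none-q , length-filter≡0 s count-s , pe₁ , pe₂
    where
    count-s : length (filter P? s) ≡ 0
    count-s = ℕ.suc-injective (ℕ.suc-injective
      (trans (sym (trans (length-filter-first p (q ++ e₂ ∷ s) none-p pe₁) (cong suc (length-filter-first q s none-q pe₂)))) eq))

Inc-≢ : ∀ {e : Edge n} {x y v} → SameEdge e (x , y) → ¬ Inc v e → x ≢ v × y ≢ v
Inc-≢ s ¬inc = (λ { refl → ¬inc (SameEdge⇒Inc (SameEdge-flip s)) }) , (λ { refl → ¬inc (SameEdge⇒Inc s) })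

≢-Inc : ∀ {e : Edge n} {x y v} → SameEdge e (x , y) → x ≢ v → y ≢ v → ¬ Inc v e
≢-Inc s x≢v y≢v inc with Inc-SameEdge s inc
... | inj₁ x≡v = x≢v x≡v
... | inj₂ y≡v = y≢v y≡v

module _ {d : Fin n → Fin n → ℚ} {R : Fin r → Edge n} {ef es : Edge n} {rest : List (Edge n)} {v a b : Fin n}
         (forest : IsRForest (closure d) R (ef ∷ es ∷ rest)) (v∉T : v ∉ terminals R)
         (rest-avoids : All (λ e → ¬ Inc v e) rest) (ef≈av : SameEdge ef (a , v)) (es≈vb : SameEdge es (v , b)) where

  private
    σ σ' : List (Edge n)
    σ  = ef ∷ es ∷ rest
    σ' = (a , b) ∷ rest

    loopless : All (λ e → proj₁ e ≢ proj₂ e) σ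
    loopless = proj₁ (proj₁ forest)

    distinct : AllPairs (λ e e' → ¬ SameEdge e e') σ
    distinct = proj₂ (proj₁ forest)

    acyclic : Acyclic σ
    acyclic = proj₁ (proj₂ forest)

    a≢v : a ≢ v
    a≢v = SameEdge-≢ ef≈av (All.lookup loopless (here refl))

    v≢b : v ≢ b
    v≢b = SameEdge-≢ es≈vb (All.lookup loopless (there (here refl)))

    a≢b : a ≢ b
    a≢b refl with ef≉es ∷ _ ← distinct = All.lookup ef≉es (here refl) (SameEdge-trans ef≈av (SameEdge-sym (SameEdge-flip es≈vb)))

    av : EdgeIn σ a v
    av = ef , here refl , ef≈av

    vb : EdgeIn σ v b
    vb = es , there (here refl) , es≈vb

    ¬ab : ¬ EdgeIn σ a b
    ¬ab ab = acyclic a (v ∷ b ∷ []) (s≤s (s≤s z≤n) , ((a≢v ∷ a≢b ∷ []) ∷ (v≢b ∷ []) ∷ [] ∷ []) ,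
                                     av ∷ vb ∷ EdgeIn-sym ab ∷ [-])

    σ'-edges : ∀ {e} → e ∈ σ' → e ≡ (a , b) ⊎ (e ∈ σ × ¬ Inc v e)
    σ'-edges (here refl) = inj₁ refl
    σ'-edges (there e∈)  = inj₂ (there (there e∈) , All.lookup rest-avoids e∈)

    bypass : IsBypass σ v a b σ'
    bypass = record { at-v = at-v ; away = away ; shortcut = λ _ _ → (a , b) , here refl , inj₁ (refl , refl) }
      where
      at-v : ∀ {e} → e ∈ σ → Inc v e → SameEdge e (a , v) ⊎ SameEdge e (v , b)
      at-v (here refl)         _   = inj₁ ef≈av
      at-v (there (here refl)) _   = inj₂ es≈vb
      at-v (there (there e∈))  inc = ⊥-elim (All.lookup rest-avoids e∈ inc)
      away : ∀ {x y} → EdgeIn σ x y → x ≢ v → y ≢ v → EdgeIn σ' x y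
      away (e , here refl , s)         x≢v y≢v = ⊥-elim (≢-Inc s x≢v y≢v (SameEdge⇒Inc ef≈av))
      away (e , there (here refl) , s) x≢v y≢v = ⊥-elim (≢-Inc s x≢v y≢v (SameEdge⇒Inc (SameEdge-flip es≈vb)))
      away (e , there (there e∈) , s)  _   _   = e , there e∈ , s

    σ'-edgeList : EdgeList (closure d) σ'
    σ'-edgeList with _ ∷ _ ∷ loopless-rest ← loopless | _ ∷ _ ∷ distinct-rest ← distinct =
      a≢b ∷ loopless-rest , All.tabulate (λ e∈ s → ¬ab (_ , there (there e∈) , SameEdge-sym s)) ∷ distinct-rest

    σ'-acyclic : Acyclic σ'
    σ'-acyclic = Acyclic-bypass av vb old acyclic avoid
      where
      old : ∀ {p q} → EdgeIn σ' p q → SameEdge (a , b) (p , q) ⊎ EdgeIn σ p q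
      old (e , e∈ , s) with σ'-edges e∈
      ... | inj₁ refl      = inj₁ s
      ... | inj₂ (e∈σ , _) = inj₂ (e , e∈σ , s)
      avoid : ∀ {p q} → EdgeIn σ' p q → p ≢ v
      avoid (_ , here refl , inj₁ (refl , refl)) = a≢v
      avoid (_ , here refl , inj₂ (refl , refl)) = v≢b ∘ sym
      avoid (_ , there e∈ , s) = proj₁ (Inc-≢ s (All.lookup rest-avoids e∈))

    ends≢v : ∀ i → proj₁ (R i) ≢ v × proj₂ (R i) ≢ v
    ends≢v = ∉terminals v∉T

    bypass-pair : ∀ {i ws} → IsPath (EdgeIn σ) (proj₁ (R i)) (proj₂ (R i)) ws →
                  BypassedPath σ' v a b (proj₁ (R i)) (proj₂ (R i)) ws
    bypass-pair {i} = bypass-path bypass (proj₁ (ends≢v i)) (proj₂ (ends≢v i))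

    σ'-onPath : ∀ e → e ∈ σ' → ∃ λ i → ∃ λ ws →
              IsPath (EdgeIn σ') (proj₁ (R i)) (proj₂ (R i)) ws × EdgeOnPath e ws
    σ'-onPath e e∈ with σ'-edges e∈ | proj₂ (proj₂ (proj₂ forest))
    ... | inj₁ refl | onPath
      with i , ws , P , (x , y , c , s) ← onPath ef (here refl)
      with ws' , P' , _ , ab ← bypass-pair P
      = i , ws' , P' , on (ab (EdgeOnPath-Inc c s (SameEdge⇒Inc ef≈av)))
      where
      on : Consec ws' a b ⊎ Consec ws' b a → EdgeOnPath (a , b) ws'
      on (inj₁ c') = a , b , c' , inj₁ (refl , refl)
      on (inj₂ c') = b , a , c' , inj₂ (refl , refl)
    ... | inj₂ (e∈σ , ¬inc) | onPath
      with i , ws , P , (x , y , c , s) ← onPath e e∈σ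
      with ws' , P' , kept , _ ← bypass-pair P
      = i , ws' , P' , x , y , kept c (proj₁ (Inc-≢ s ¬inc)) (proj₂ (Inc-≢ s ¬inc)) , s

  IsRForest-bypass : IsRForest (closure d) R ((a , b) ∷ rest)
  IsRForest-bypass =
    σ'-edgeList , σ'-acyclic ,
    (λ i → ConnIn-bypass bypass (proj₁ (ends≢v i)) (proj₂ (ends≢v i)) (proj₁ (proj₂ (proj₂ forest)) i)) ,
    σ'-onPath

-- Counting the vertices of a forest

indicator : ∀ {P : Set} → Dec P → ℕ
indicator (yes _) = 1
indicator (no _)  = 0

Sum : (A → ℕ) → List A → ℕ
Sum f xs = sum (map f xs)

Sum-cong : ∀ {f g : A → ℕ} xs → (∀ x → f x ≡ g x) → Sum f xs ≡ Sum g xs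
Sum-cong []       f≗g = refl
Sum-cong (x ∷ xs) f≗g = cong₂ _+_ (f≗g x) (Sum-cong xs f≗g)

Sum-mono : ∀ {f g : A → ℕ} xs → (∀ x → f x ≤ g x) → Sum f xs ≤ Sum g xs
Sum-mono []       f≤g = z≤n
Sum-mono (x ∷ xs) f≤g = ℕ.+-mono-≤ (f≤g x) (Sum-mono xs f≤g)

Sum-+ : ∀ (f g : A → ℕ) xs → Sum (λ x → f x + g x) xs ≡ Sum f xs + Sum g xs
Sum-+ f g []       = refl
Sum-+ f g (x ∷ xs) = trans (cong (f x + g x +_) (Sum-+ f g xs)) (interchange (f x) (g x) (Sum f xs) (Sum g xs))

Sum-* : ∀ k (f : A → ℕ) xs → Sum (λ x → k * f x) xs ≡ k * Sum f xs
Sum-* k f []       = sym (ℕ.*-zeroʳ k)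
Sum-* k f (x ∷ xs) = trans (cong (k * f x +_) (Sum-* k f xs)) (sym (ℕ.*-distribˡ-+ k (f x) (Sum f xs)))

Sum-zero : ∀ (xs : List A) → Sum (λ _ → 0) xs ≡ 0
Sum-zero []       = refl
Sum-zero (x ∷ xs) = Sum-zero xs

length-filter-∷ : ∀ {P : A → Set} (P? : Decidable P) x xs →
                  length (filter P? (x ∷ xs)) ≡ indicator (P? x) + length (filter P? xs)
length-filter-∷ P? x xs with P? x
... | yes _ = refl
... | no _  = refl

length-filter≡Sum : ∀ {P : A → Set} (P? : Decidable P) xs → length (filter P? xs) ≡ Sum (indicator ∘ P?) xs
length-filter≡Sum P? []       = refl
length-filter≡Sum P? (x ∷ xs) = trans (length-filter-∷ P? x xs) (cong (indicator (P? x) +_) (length-filter≡Sum P? xs))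

length-++-∷ : ∀ (as : List A) {x} bs → length (as ++ x ∷ bs) ≡ suc (length (as ++ bs))
length-++-∷ []       bs = refl
length-++-∷ (a ∷ as) bs = cong suc (length-++-∷ as bs)

∈-++-∷⁻ : ∀ (as : List A) {x y} bs → y ∈ as ++ x ∷ bs → y ≢ x → y ∈ as ++ bs
∈-++-∷⁻ []       bs (here refl) y≢x = ⊥-elim (y≢x refl)
∈-++-∷⁻ []       bs (there y∈)  _   = y∈
∈-++-∷⁻ (a ∷ as) bs (here refl) _   = here refl
∈-++-∷⁻ (a ∷ as) bs (there y∈)  y≢x = there (∈-++-∷⁻ as bs y∈ y≢x)

Unique-⊆-length : ∀ {xs ys : List A} → Unique xs → xs ⊆ ys → length xs ≤ length ys
Unique-⊆-length {xs = []}     _          _   = z≤n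
Unique-⊆-length {xs = x ∷ xs} (x∉ ∷ un) sub with as , bs , refl ← ∈-∃++ (sub (here refl)) =
  subst (suc (length xs) ≤_) (sym (length-++-∷ as bs))
        (s≤s (Unique-⊆-length un (λ y∈ → ∈-++-∷⁻ as bs (sub (there y∈)) (All.lookup x∉ y∈ ∘ sym))))

Unique-length : ∀ {ws : List (Fin n)} → Unique ws → length ws ≤ n
Unique-length {n} {ws} u = subst (length ws ≤_) (length-tabulate {n = n} id) (Unique-⊆-length u (λ {x} _ → ∈-allFin x))

Sum-indicator-∉ : ∀ (a : Fin n) xs → a ∉ xs → Sum (λ v → indicator (a ≟ v)) xs ≡ 0
Sum-indicator-∉ a []       _  = refl
Sum-indicator-∉ a (x ∷ xs) a∉ with a ≟ x
... | yes refl = ⊥-elim (a∉ (here refl))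
... | no _     = Sum-indicator-∉ a xs (a∉ ∘ there)

Sum-indicator-∈ : ∀ (a : Fin n) xs → Unique xs → a ∈ xs → Sum (λ v → indicator (a ≟ v)) xs ≡ 1
Sum-indicator-∈ a (x ∷ xs) (x∉ ∷ un) a∈ with a ≟ x | a∈
... | yes refl | _          = cong suc (Sum-indicator-∉ a xs (λ a∈' → All.lookup x∉ a∈' refl))
... | no a≢x   | here a≡x  = ⊥-elim (a≢x a≡x)
... | no _     | there a∈' = Sum-indicator-∈ a xs un a∈'

Sum-Inc : ∀ (e : Edge n) → proj₁ e ≢ proj₂ e → Sum (λ v → indicator (Inc? v e)) (allFin n) ≡ 2
Sum-Inc {n} (x , y) x≢y = begin
  Sum (λ v → indicator (Inc? v (x , y))) (allFin n)                ≡⟨ Sum-cong (allFin n) split ⟩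
  Sum (λ v → indicator (x ≟ v) + indicator (y ≟ v)) (allFin n)     ≡⟨ Sum-+ _ _ (allFin n) ⟩
  Sum (λ v → indicator (x ≟ v)) (allFin n) + Sum (λ v → indicator (y ≟ v)) (allFin n)
    ≡⟨ cong₂ _+_ (Sum-indicator-∈ x (allFin n) (allFin⁺ n) (∈-allFin x))
                 (Sum-indicator-∈ y (allFin n) (allFin⁺ n) (∈-allFin y)) ⟩
  2                                                                 ∎
  where
  open ≡.≡-Reasoning
  split : ∀ v → indicator (Inc? v (x , y)) ≡ indicator (x ≟ v) + indicator (y ≟ v)
  split v with x ≟ v | y ≟ v
  ... | yes refl | yes refl = ⊥-elim (x≢y refl)
  ... | yes _    | no _     = refl
  ... | no _     | yes _    = refl
  ... | no _     | no _     = refl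

handshake : ∀ (σ : List (Edge n)) → All (λ e → proj₁ e ≢ proj₂ e) σ → Sum (λ v → deg v σ) (allFin n) ≡ 2 * length σ
handshake {n} []       _             = Sum-zero (allFin n)
handshake {n} (e ∷ σ) (e-loopless ∷ loopless) = begin
  Sum (λ v → deg v (e ∷ σ)) (allFin n)
    ≡⟨ Sum-cong (allFin n) (λ v → length-filter-∷ (Inc? v) e σ) ⟩
  Sum (λ v → indicator (Inc? v e) + deg v σ) (allFin n)
    ≡⟨ Sum-+ _ _ (allFin n) ⟩
  Sum (λ v → indicator (Inc? v e)) (allFin n) + Sum (λ v → deg v σ) (allFin n)
    ≡⟨ cong₂ _+_ (Sum-Inc e e-loopless) (handshake σ loopless) ⟩
  2 + 2 * length σ
    ≡⟨ ℕ.*-suc 2 (length σ) ⟨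
  2 * length (e ∷ σ)
    ∎
  where open ≡.≡-Reasoning

IsForest : List (Edge n) → Set
IsForest σ = All (λ e → proj₁ e ≢ proj₂ e) σ × AllPairs (λ e e' → ¬ SameEdge e e') σ × Acyclic σ

Leaf : List (Edge n) → Set
Leaf {n} σ = ∃ λ (l : Fin n) → ∃ λ e → e ∈ σ × Inc l e × (∀ {e'} → e' ∈ σ → Inc l e' → SameEdge e' e)

-- Extend a path at its first vertex until that vertex has no other neighbour;
-- acyclicity and the bound n on path lengths make this stop at a leaf.
extend-to-leaf : ∀ {σ : List (Edge n)} k x y ys → IsForest σ → n < length (x ∷ y ∷ ys) + k →
                 Unique (x ∷ y ∷ ys) → Linked (EdgeIn σ) (x ∷ y ∷ ys) → Leaf σ
extend-to-leaf {n} zero x y ys _ n<len un _ =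
  ⊥-elim (ℕ.<⇒≱ (subst (n <_) (ℕ.+-identityʳ _) n<len) (Unique-length un))
extend-to-leaf {n} {σ} (suc k) x y ys (loopless , distinct , acyclic) n<len un lk@(xy ∷ _)
  with any? (λ z → ¬? (z ≟ y) ×-dec EdgeIn? σ x z) (allFin n)
... | no none = x , proj₁ xy , proj₁ (proj₂ xy) , SameEdge⇒Inc (SameEdge-flip (proj₂ (proj₂ xy))) , only
  where
  only : ∀ {e} → e ∈ σ → Inc x e → SameEdge e (proj₁ xy)
  only {e} e∈ inc with z , e≈xz ← otherEnd inc with z ≟ y
  ... | yes refl = SameEdge-trans (SameEdge-flip e≈xz) (SameEdge-sym (proj₂ (proj₂ xy)))
  ... | no z≢y   = ⊥-elim (none (Any.map (λ { refl → z≢y , e , e∈ , SameEdge-flip e≈xz }) (∈-allFin z)))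
... | yes found with z , z≢y , xz ← satisfied found with z ∈? (x ∷ y ∷ ys)
...   | no z∉ = extend-to-leaf k z x (y ∷ ys) (loopless , distinct , acyclic)
                  (subst (n <_) (ℕ.+-suc (length (x ∷ y ∷ ys)) k) n<len) (¬Any⇒All¬ _ z∉ ∷ un) (EdgeIn-sym xz ∷ lk)
...   | yes (here refl)         = ⊥-elim (EdgeIn-≢ loopless xz refl)
...   | yes (there (here refl)) = ⊥-elim (z≢y refl)
...   | yes (there (there z∈)) with as , bs , refl ← ∈-∃++ z∈ =
  ⊥-elim (acyclic x (y ∷ as ++ [ z ]) (2≤len as , un' , Linked-∷ʳ⁺ (Linked-⊑ (⊑-snoc (x ∷ y ∷ as) z bs) lk) zx))
  where
  2≤len : ∀ as → 2 ≤ length (y ∷ as ++ [ z ])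
  2≤len []      = s≤s (s≤s z≤n)
  2≤len (_ ∷ _) = s≤s (s≤s z≤n)
  un' : Unique (x ∷ y ∷ as ++ [ z ])
  un' = AllPairs-++⁻ˡ (x ∷ y ∷ as ++ [ z ]) (subst Unique (cong (λ zs → x ∷ y ∷ zs) (sym (++-assoc as [ z ] bs))) un)
  zx : EdgeIn σ (lastOr x (y ∷ as ++ [ z ])) x
  zx = subst (λ w → EdgeIn σ w x) (sym (lastOr-++ y as z [])) (EdgeIn-sym xz)

leaf : ∀ {σ : List (Edge n)} {e} → e ∈ σ → IsForest σ → Leaf σ
leaf {n} {e = e} e∈ forest@(loopless , _) =
  extend-to-leaf n (proj₁ e) (proj₂ e) [] forest (s≤s (ℕ.n≤1+n n)) ((All.lookup loopless e∈ ∷ []) ∷ [] ∷ [])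
                 ((e , e∈ , inj₁ (refl , refl)) ∷ [-])

#vertices : List (Edge n) → ℕ
#vertices {n} σ = length (filter (_∈? forestVertices σ) (allFin n))

forestVertices-⊆ : ∀ {σ σ' : List (Edge n)} → σ' ⊆ σ → forestVertices σ' ⊆ forestVertices σ
forestVertices-⊆ {σ' = σ'} sub v∈ with e , e∈ , inc ← ∈forestVertices⁻ σ' v∈ = ∈forestVertices⁺ (sub e∈) inc

#vertices-< : ∀ {σ σ' : List (Edge n)} {l} → σ' ⊆ σ → l ∈ forestVertices σ → l ∉ forestVertices σ' →
              suc (#vertices σ') ≤ #vertices σ
#vertices-< {n} {σ} {σ'} {l} sub l∈ l∉ =
  Unique-⊆-length (¬Any⇒All¬ _ (l∉ ∘ proj₂ ∘ ∈-filter⁻ (_∈? forestVertices σ') {xs = allFin n}) ∷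
                   Unique.filter⁺ (_∈? forestVertices σ') (allFin⁺ n)) ⊆σ
  where
  ⊆σ : l ∷ filter (_∈? forestVertices σ') (allFin n) ⊆ filter (_∈? forestVertices σ) (allFin n)
  ⊆σ (here refl) = ∈-filter⁺ (_∈? forestVertices σ) (∈-allFin l) l∈
  ⊆σ (there v∈) with v∈all , v∈σ' ← ∈-filter⁻ (_∈? forestVertices σ') {xs = allFin n} v∈ =
    ∈-filter⁺ (_∈? forestVertices σ) v∈all (forestVertices-⊆ sub v∈σ')

∈-++-∷⁺ : ∀ (as : List A) {x bs} → as ++ bs ⊆ as ++ x ∷ bs
∈-++-∷⁺ as y∈ with ∈-++⁻ as y∈
... | inj₁ y∈as = ∈-++⁺ˡ y∈as
... | inj₂ y∈bs = ∈-++⁺ʳ as (there y∈bs)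

nonempty : ∀ {m} (xs : List A) → length xs ≡ suc m → ∃ (_∈ xs)
nonempty (x ∷ _) _ = x , here refl

-- Removing the edge at a leaf loses exactly one vertex.
forest-size′ : ∀ m (σ : List (Edge n)) {e} → e ∈ σ → length σ ≡ suc m → IsForest σ → suc (length σ) ≤ #vertices σ
forest-size′ zero σ e∈ len (loopless , _) =
  subst (_≤ #vertices σ) (cong suc (sym len))
        (2≤length-filter _ (∈-allFin _) (∈-allFin _) (All.lookup loopless e∈)
                         (∈forestVertices⁺ e∈ (inj₁ refl)) (∈forestVertices⁺ e∈ (inj₂ refl)))
forest-size′ (suc m) σ e∈ len forest@(loopless , distinct , acyclic)
  with l , el , el∈ , l∈el , only ← leaf e∈ forest
  with as , bs , refl ← ∈-∃++ el∈
  with len' ← ℕ.suc-injective (trans (sym (length-++-∷ as bs)) len)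
  with e' , e'∈ ← nonempty (as ++ bs) len' = begin
  suc (length σ)            ≡⟨ cong suc (length-++-∷ as bs) ⟩
  suc (suc (length σ'))     ≤⟨ s≤s (forest-size′ m σ' e'∈ len' forest') ⟩
  suc (#vertices σ')        ≤⟨ #vertices-< (∈-++-∷⁺ as) (∈forestVertices⁺ el∈ l∈el) l∉ ⟩
  #vertices σ               ∎
  where
  open ℕ.≤-Reasoning
  σ' : List (Edge _)
  σ' = as ++ bs
  forest' : IsForest σ'
  forest' = All-++⁻-mid as loopless , AllPairs-++⁻-mid as distinct , Acyclic-⊆ (∈-++-∷⁺ as) acyclic
  l∉ : l ∉ forestVertices σ'
  l∉ l∈ with e'' , e''∈ , inc ← ∈forestVertices⁻ σ' l∈ with AllPairs-mid as distinct e''∈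
  ... | inj₁ e''≉el = e''≉el (only (∈-++-∷⁺ as e''∈) inc)
  ... | inj₂ el≉e'' = el≉e'' (SameEdge-sym (only (∈-++-∷⁺ as e''∈) inc))

forest-size : ∀ {σ : List (Edge n)} {e} → e ∈ σ → IsForest σ → suc (length σ) ≤ #vertices σ
forest-size {σ = x ∷ xs} e∈ = forest-size′ (length xs) (x ∷ xs) e∈ refl

length-terminals : ∀ (R : Fin r → Edge n) → length (terminals R) ≡ 2 * r
length-terminals {r} R = trans (go (allFin r)) (cong (2 *_) (length-tabulate {n = r} id))
  where
  go : ∀ is → length (concatMap (endpoints ∘ R) is) ≡ 2 * length is
  go []       = refl
  go (i ∷ is) = trans (cong (suc ∘ suc) (go is)) (sym (ℕ.*-suc 2 (length is)))

indicator-split : ∀ {P Q : Set} (p : Dec P) (q : Dec Q) → indicator (p ×-dec ¬? q) + indicator (p ×-dec q) ≡ indicator p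
indicator-split (yes _) (yes _) = refl
indicator-split (yes _) (no _)  = refl
indicator-split (no _)  _       = refl

indicator-deg : ∀ {P Q : Set} (p : Dec P) (q : Dec Q) {D} → (P → 1 ≤ D) → (P → ¬ Q → 3 ≤ D) →
                3 * indicator (p ×-dec ¬? q) + indicator (p ×-dec q) ≤ D
indicator-deg (yes p) (yes _) 1≤D _   = 1≤D p
indicator-deg (yes p) (no ¬q) _   3≤D = 3≤D p ¬q
indicator-deg (no _)  _       _   _   = z≤n

module _ (R : Fin r → Edge n) (σ : List (Edge n)) where

  private
    V? : ∀ v → Dec (v ∈ forestVertices σ)
    V? v = v ∈? forestVertices σ
    T? : ∀ v → Dec (v ∈ terminals R)
    T? v = v ∈? terminals R

  #terminals : ℕ
  #terminals = length (filter (λ v → V? v ×-dec T? v) (allFin n))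

  private
    ΣV : (Fin n → ℕ) → ℕ
    ΣV f = Sum f (allFin n)

    isNonTerminal isTerminal : Fin n → ℕ
    isNonTerminal v = indicator (isNonTerminal? R σ v)
    isTerminal    v = indicator (V? v ×-dec T? v)

    #nonTerminal≡ : numNonTerminal R σ ≡ ΣV isNonTerminal
    #nonTerminal≡ = length-filter≡Sum (isNonTerminal? R σ) (allFin n)

    #terminals≡ : #terminals ≡ ΣV isTerminal
    #terminals≡ = length-filter≡Sum (λ v → V? v ×-dec T? v) (allFin n)

  #vertices-split : #vertices σ ≡ numNonTerminal R σ + #terminals
  #vertices-split = begin
    #vertices σ                                ≡⟨ length-filter≡Sum V? (allFin n) ⟩
    ΣV (indicator ∘ V?)                        ≡⟨ Sum-cong (allFin n) (λ v → indicator-split (V? v) (T? v)) ⟨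
    ΣV (λ v → isNonTerminal v + isTerminal v)  ≡⟨ Sum-+ isNonTerminal isTerminal (allFin n) ⟩
    ΣV isNonTerminal + ΣV isTerminal           ≡⟨ cong₂ _+_ #nonTerminal≡ #terminals≡ ⟨
    numNonTerminal R σ + #terminals            ∎
    where open ≡.≡-Reasoning

  #terminals≤ : #terminals ≤ 2 * r
  #terminals≤ = subst (#terminals ≤_) (length-terminals R)
                      (Unique-⊆-length (Unique.filter⁺ (λ v → V? v ×-dec T? v) (allFin⁺ n))
                                       (proj₂ ∘ proj₂ ∘ ∈-filter⁻ (λ v → V? v ×-dec T? v) {xs = allFin n}))

  degree-sum : All (λ e → proj₁ e ≢ proj₂ e) σ → Branching R σ → 3 * numNonTerminal R σ + #terminals ≤ 2 * length σ
  degree-sum loopless branching = begin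
    3 * numNonTerminal R σ + #terminals             ≡⟨ cong₂ (λ x y → 3 * x + y) #nonTerminal≡ #terminals≡ ⟩
    3 * ΣV isNonTerminal + ΣV isTerminal            ≡⟨ cong (_+ ΣV isTerminal) (Sum-* 3 isNonTerminal (allFin n)) ⟨
    ΣV (λ v → 3 * isNonTerminal v) + ΣV isTerminal  ≡⟨ Sum-+ (λ v → 3 * isNonTerminal v) isTerminal (allFin n) ⟨
    ΣV (λ v → 3 * isNonTerminal v + isTerminal v)   ≤⟨ Sum-mono (allFin n) vertex-bound ⟩
    ΣV (λ v → deg v σ)                              ≡⟨ handshake σ loopless ⟩
    2 * length σ                                    ∎
    where
    open ℕ.≤-Reasoning
    1≤deg : ∀ v → v ∈ forestVertices σ → 1 ≤ deg v σ
    1≤deg v v∈ with e , e∈ , inc ← ∈forestVertices⁻ σ v∈ = ∈-length (∈-filter⁺ (Inc? v) e∈ inc)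
    vertex-bound : ∀ v → 3 * isNonTerminal v + isTerminal v ≤ deg v σ
    vertex-bound v = indicator-deg (V? v) (T? v) (1≤deg v) (λ v∈ v∉ → branching v (v∈ , v∉))

nonTerminal-count : ∀ (R : Fin r → Edge n) {σ e} → e ∈ σ → IsForest σ → Branching R σ → numNonTerminal R σ ≤ 2 * r ∸ 2
nonTerminal-count {r} R {σ} e∈ forest@(loopless , _) branching =
  ℕ.m+n≤o⇒m≤o∸n N (ℕ.≤-trans N+2≤T (#terminals≤ R σ))
  where
  N T E : ℕ
  N = numNonTerminal R σ
  T = #terminals R σ
  E = length σ
  N+2≤T : N + 2 ≤ T
  N+2≤T = ℕ.+-cancelˡ-≤ (2 * N + T) (N + 2) T (begin
    2 * N + T + (N + 2)      ≡⟨ solve 2 (λ N T → con 2 :* N :+ T :+ (N :+ con 2) := con 3 :* N :+ T :+ con 2) refl N T ⟩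
    3 * N + T + 2            ≤⟨ ℕ.+-monoˡ-≤ 2 (degree-sum R σ loopless branching) ⟩
    2 * E + 2                ≡⟨ solve 1 (λ E → con 2 :* E :+ con 2 := con 2 :* (con 1 :+ E)) refl E ⟩
    2 * suc E                ≤⟨ ℕ.*-monoʳ-≤ 2 (forest-size e∈ forest) ⟩
    2 * #vertices σ          ≡⟨ cong (2 *_) (#vertices-split R σ) ⟩
    2 * (N + T)              ≡⟨ solve 2 (λ N T → con 2 :* (N :+ T) := con 2 :* N :+ T :+ T) refl N T ⟩
    2 * N + T + T            ∎)
    where
    open ℕ.≤-Reasoning
    open +-*-Solver

-- Shortest-path distances

record IsPseudometric (d : Fin n → Fin n → ℚ) : Set where
  field
    nonneg    : ∀ u v → 0ℚ ≤ℚ d u v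
    symmetric : ∀ u v → d u v ≡ d v u
    triangle  : ∀ u v w → d u w ≤ℚ d u v +ℚ d v w

Ends-∷ʳ⁻ : ∀ {u v : Fin n} ws → Ends u v ws → ∃ λ ini → ws ≡ ini ++ [ v ]
Ends-∷ʳ⁻ (x ∷ xs) (_ , refl) = init-last x xs

Ends-++ : ∀ {u v w : Fin n} as bs → Ends u v (as ++ [ v ]) → Ends v w (v ∷ bs) → Ends u w (as ++ v ∷ bs)
Ends-++ []       bs (u≡v , _)  (_ , e) = u≡v , e
Ends-++ (a ∷ as) bs (u≡a , _)  (_ , e) = u≡a , trans (lastOr-++ a as _ bs) e

walk⇒path′ : ∀ {J : Fin n → Fin n → Set} {u w} ws → Ends u w ws → Linked J ws →
             ∃ λ ws' → IsPath J u w ws' × Shorter J ws' ws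
walk⇒path′ (x ∷ xs) (refl , refl) l with ws , P , _ , short ← walk⇒path x xs l = x ∷ ws , P , short

module _ {G : Network n} (undirected : IsUndirectedNetwork G)
         {d : Fin n → Fin n → ℚ} (dist : ∀ u v → IsDist G u v (d u v)) where

  private
    Adj-sym : ∀ {u v} → Adj G u v → Adj G v u
    Adj-sym = proj₁ undirected _ _

    len-nonneg : NonNegOn G (Adj G)
    len-nonneg a = ℚ.<⇒≤ (proj₂ (proj₂ (proj₂ undirected)) _ _ a)

    d≤ : ∀ {u v ws} → IsPath (Adj G) u v ws → d u v ≤ℚ pathLen G ws
    d≤ = proj₂ (dist _ _) _

  dist≤len : ∀ u v → Adj G u v → d u v ≤ℚ len G u v
  dist≤len u v a = subst (d u v ≤ℚ_) (ℚ.+-identityʳ (len G u v))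
    (d≤ ((refl , refl) , ((λ { refl → proj₁ (proj₂ undirected) u a }) ∷ []) ∷ [] ∷ [] , a ∷ [-]))

  IsDist⇒IsPseudometric : IsPseudometric d
  IsDist⇒IsPseudometric = record { nonneg = nonneg ; symmetric = d-sym ; triangle = triangle }
    where
    nonneg : ∀ u v → 0ℚ ≤ℚ d u v
    nonneg u v with ws , (_ , _ , l) , ws-len ← proj₁ (dist u v) = subst (0ℚ ≤ℚ_) ws-len (pathLen-nonneg len-nonneg l)

    d≤reverse : ∀ u v → d u v ≤ℚ d v u
    d≤reverse u v with ws , P@(_ , _ , l) , ws-len ← proj₁ (dist v u) =
      subst (d u v ≤ℚ_) (trans (pathLen-reverse G ws (λ c → proj₁ (proj₂ (proj₂ undirected)) _ _ (Linked⇒Consec l c))) ws-len)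
            (d≤ (path-reverse Adj-sym P))

    d-sym : ∀ u v → d u v ≡ d v u
    d-sym u v = ℚ.≤-antisym (d≤reverse u v) (d≤reverse v u)

    triangle  : ∀ u v w → d u w ≤ℚ d u v +ℚ d v w
    triangle u v w
      with ws₁ , (e₁ , _ , l₁) , len₁ ← proj₁ (dist u v)
      with ini , refl ← Ends-∷ʳ⁻ ws₁ e₁
      with y ∷ ys , ((refl , e₂) , _ , l₂) , len₂ ← proj₁ (dist v w)
      with Q , PQ , short ← walk⇒path′ (ini ++ v ∷ ys) (Ends-++ ini ys e₁ (refl , e₂)) (Linked-++ ini v ys l₁ l₂)
      = begin
        d u w                                        ≤⟨ d≤ PQ ⟩
        pathLen G Q                                  ≤⟨ short G len-nonneg ⟩
        pathLen G (ini ++ v ∷ ys)                    ≡⟨ pathLen-++ G ini v ys ⟩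
        pathLen G (ini ++ [ v ]) +ℚ pathLen G (v ∷ ys) ≡⟨ cong₂ _+ℚ_ len₁ len₂ ⟩
        d u v +ℚ d v w                                ∎
      where open ℚ.≤-Reasoning

-- Orderings that connect the relevant pairs in time

totalLen : Network n → List (Edge n) → ℚ
totalLen H σ = foldr _+ℚ_ 0ℚ (map (λ e → len H (proj₁ e) (proj₂ e)) σ)

totalLen-↭ : ∀ (H : Network n) {σ τ} → σ ↭ τ → totalLen H σ ≡ totalLen H τ
totalLen-↭ H ↭.refl          = refl
totalLen-↭ H (↭.prep e p)    = cong (len H (proj₁ e) (proj₂ e) +ℚ_) (totalLen-↭ H p)
totalLen-↭ H (↭.swap e f p)  = trans (cong (λ T → x +ℚ (y +ℚ T)) (totalLen-↭ H p))
                                     (trans (sym (ℚ.+-assoc x y _)) (trans (cong (_+ℚ _) (ℚ.+-comm x y)) (ℚ.+-assoc y x _)))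
  where
  x y : ℚ
  x = len H (proj₁ e) (proj₂ e)
  y = len H (proj₁ f) (proj₂ f)
totalLen-↭ H (↭.trans p p')  = trans (totalLen-↭ H p) (totalLen-↭ H p')

Prefix : List A → List A → Set
Prefix L σ = ∃ λ M → L ++ M ≡ σ

Prefix-++ : ∀ {L xs : List A} ys → Prefix L xs → Prefix L (xs ++ ys)
Prefix-++ {L = L} ys (M , refl) = M ++ ys , sym (++-assoc L M ys)

Prefix-++⁺ : ∀ (xs : List A) {L ys} → Prefix L ys → Prefix (xs ++ L) (xs ++ ys)
Prefix-++⁺ xs {L} (M , refl) = M , ++-assoc xs L M

Prefix-⊆ : ∀ {L σ : List A} → Prefix L σ → L ⊆ σ
Prefix-⊆ (M , refl) = ∈-++⁺ˡ

Prefix-All : ∀ {P : A → Set} {L σ} → Prefix L σ → All P σ → All P L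
Prefix-All {L = L} (M , refl) = ++⁻ˡ L

Prefix-++-∷ : ∀ (xs : List A) {y ys L} → Prefix L (xs ++ y ∷ ys) →
              Prefix L xs ⊎ ∃ λ L' → L ≡ xs ++ y ∷ L' × Prefix L' ys
Prefix-++-∷ []       {L = []}    _          = inj₁ ([] , refl)
Prefix-++-∷ []       {L = l ∷ L} (M , refl) = inj₂ (L , refl , M , refl)
Prefix-++-∷ (x ∷ xs) {L = []}    _          = inj₁ (x ∷ xs , refl)
Prefix-++-∷ (x ∷ xs) {L = l ∷ L} (M , eq) with refl , eq' ← ∷-injective eq with Prefix-++-∷ xs (M , eq')
... | inj₁ (M' , eq'')     = inj₁ (M' , cong (x ∷_) eq'')
... | inj₂ (L' , refl , pre) = inj₂ (L' , refl , pre)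

Prefix-take : ∀ k (σ : List A) → Prefix (take k σ) σ
Prefix-take k σ = drop k σ , take++drop≡id k σ

take-length : ∀ {L σ : List A} → Prefix L σ → take (length L) σ ≡ L
take-length {L = []}    _          = refl
take-length {L = l ∷ L} (M , refl) = cong (l ∷_) (take-length (M , refl))

↭-pull : ∀ (p : List A) q y s → p ++ q ++ y ∷ s ↭ y ∷ (p ++ q) ++ s
↭-pull p q y s = ↭-trans (↭-reflexive (sym (++-assoc p q (y ∷ s)))) (shift y (p ++ q) s)

↭-pull₂ : ∀ (p : List A) x q y s → p ++ x ∷ q ++ y ∷ s ↭ x ∷ y ∷ (p ++ q) ++ s
↭-pull₂ p x q y s = ↭-trans (shift x p (q ++ y ∷ s)) (↭-prep x (↭-pull p q y s))

ConnectsWithin : Network n → (Fin r → Edge n) → List (Edge n) → (Fin r → ℚ) → Set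
ConnectsWithin H R σ t = ∀ i → ∃ λ L → Prefix L σ × ConnIn L (proj₁ (R i)) (proj₂ (R i)) × totalLen H L ≤ℚ t i

totalLen-closure≤ : ∀ {G : Network n} {d} → (∀ u v → Adj G u v → d u v ≤ℚ len G u v) →
                    ∀ {L} → All (λ e → Adj G (proj₁ e) (proj₂ e)) L → totalLen (closure d) L ≤ℚ totalLen G L
totalLen-closure≤ d≤len []       = ℚ.≤-refl
totalLen-closure≤ d≤len (a ∷ as) = ℚ.+-mono-≤ (d≤len _ _ a) (totalLen-closure≤ d≤len as)

ConnectsWithin-closure : ∀ {G : Network n} {d} {R : Fin r → Edge n} {σ t} → (∀ u v → Adj G u v → d u v ≤ℚ len G u v) →
                         All (λ e → Adj G (proj₁ e) (proj₂ e)) σ → (∀ i → IsConnTime G σ (R i) (t i)) →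
                         ConnectsWithin (closure d) R σ t
ConnectsWithin-closure {σ = σ} {t} d≤len adj times i with (k , conn , t≡) , _ ← times i =
  take k σ , Prefix-take k σ , conn ,
  subst (_ ≤ℚ_) t≡ (totalLen-closure≤ d≤len (Prefix-All (Prefix-take k σ) adj))

module _ {d : Fin n → Fin n → ℚ} (pm : IsPseudometric d) {p q s : List (Edge n)} {ef es : Edge n} {v a b : Fin n}
         (p-avoids : All (λ e → ¬ Inc v e) p) (q-avoids : All (λ e → ¬ Inc v e) q) (s-avoids : All (λ e → ¬ Inc v e) s)
         (ef≈av : SameEdge ef (a , v)) (es≈vb : SameEdge es (v , b)) (ef≉es : ¬ SameEdge ef es) where

  open IsPseudometric pm

  private
    σ σ' : List (Edge n)
    σ  = p ++ ef ∷ q ++ es ∷ s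
    σ' = p ++ q ++ (a , b) ∷ s

    edgeLen : Edge n → ℚ
    edgeLen e = d (proj₁ e) (proj₂ e)

    edgeLen-SameEdge : ∀ {e x y} → SameEdge e (x , y) → edgeLen e ≡ d x y
    edgeLen-SameEdge (inj₁ (refl , refl)) = refl
    edgeLen-SameEdge (inj₂ (refl , refl)) = symmetric _ _

    at-v : ∀ {e} → e ∈ σ → Inc v e → SameEdge e (a , v) ⊎ SameEdge e (v , b)
    at-v e∈ inc with ∈-resp-↭ (↭-pull₂ p ef q es s) e∈
    ... | here refl         = inj₁ ef≈av
    ... | there (here refl) = inj₂ es≈vb
    ... | there (there e∈') = ⊥-elim (All.lookup (++⁺ (++⁺ p-avoids q-avoids) s-avoids) e∈' inc)

    bypass-prefix : ∀ {L L'} → L ⊆ σ → (∀ {e} → e ∈ L → ¬ Inc v e → e ∈ L') →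
                    (EdgeIn L a v → EdgeIn L v b → (a , b) ∈ L') → IsBypass L v a b L'
    bypass-prefix sub keep short = record
      { at-v     = at-v ∘ sub
      ; away     = λ { (e , e∈ , s) x≢v y≢v → e , keep e∈ (≢-Inc s x≢v y≢v) , s }
      ; shortcut = λ av vb → (a , b) , short av vb , inj₁ (refl , refl)
      }

    no-edge-at-v : ∀ {L b'} → All (λ e → ¬ Inc v e) L → ¬ EdgeIn L v b'
    no-edge-at-v avoids (e , e∈ , s) = All.lookup avoids e∈ (SameEdge⇒Inc (SameEdge-flip s))

    PrefixBypass : List (Edge n) → Set
    PrefixBypass L = ∃ λ L' → Prefix L' σ' × IsBypass L v a b L' × totalLen (closure d) L' ≤ℚ totalLen (closure d) L

    prefix-before : ∀ {L} → Prefix L σ → Prefix L p → PrefixBypass L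
    prefix-before pre pre-p =
      _ , Prefix-++ (q ++ (a , b) ∷ s) pre-p ,
      bypass-prefix (Prefix-⊆ pre) (λ e∈ _ → e∈) (λ _ → ⊥-elim ∘ no-edge-at-v (Prefix-All pre-p p-avoids)) ,
      ℚ.≤-refl

    prefix-between : ∀ {L₁} → Prefix (p ++ ef ∷ L₁) σ → Prefix L₁ q → PrefixBypass (p ++ ef ∷ L₁)
    prefix-between {L₁} pre pre-q =
      p ++ L₁ , Prefix-++⁺ p (Prefix-++ ((a , b) ∷ s) pre-q) , bypass-prefix (Prefix-⊆ pre) keep (λ _ → ⊥-elim ∘ no-vb) ,
      subst (totalLen (closure d) (p ++ L₁) ≤ℚ_) (sym (totalLen-↭ (closure d) (shift ef p L₁))) (x≤y+x (nonneg _ _))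
      where
      keep : ∀ {e} → e ∈ p ++ ef ∷ L₁ → ¬ Inc v e → e ∈ p ++ L₁
      keep e∈ ¬inc with ∈-resp-↭ (shift ef p L₁) e∈
      ... | here refl  = ⊥-elim (¬inc (SameEdge⇒Inc ef≈av))
      ... | there e∈' = e∈'
      no-vb : ¬ EdgeIn (p ++ ef ∷ L₁) v b
      no-vb (e , e∈ , s) with ∈-resp-↭ (shift ef p L₁) e∈
      ... | here refl  = ef≉es (SameEdge-trans s (SameEdge-sym es≈vb))
      ... | there e∈' = no-edge-at-v (++⁺ p-avoids (Prefix-All pre-q q-avoids)) (e , e∈' , s)

    prefix-after : ∀ {L₂} → Prefix (p ++ ef ∷ q ++ es ∷ L₂) σ → Prefix L₂ s → PrefixBypass (p ++ ef ∷ q ++ es ∷ L₂)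
    prefix-after {L₂} pre pre-s =
      p ++ q ++ (a , b) ∷ L₂ , Prefix-++⁺ p (Prefix-++⁺ q (Prefix-++⁺ [ (a , b) ] pre-s)) ,
      bypass-prefix (Prefix-⊆ pre) keep (λ _ _ → ∈-resp-↭ (↭-sym (↭-pull p q (a , b) L₂)) (here refl)) ,
      shorter
      where
      keep : ∀ {e} → e ∈ p ++ ef ∷ q ++ es ∷ L₂ → ¬ Inc v e → e ∈ p ++ q ++ (a , b) ∷ L₂
      keep e∈ ¬inc with ∈-resp-↭ (↭-pull₂ p ef q es L₂) e∈
      ... | here refl          = ⊥-elim (¬inc (SameEdge⇒Inc ef≈av))
      ... | there (here refl)  = ⊥-elim (¬inc (SameEdge⇒Inc (SameEdge-flip es≈vb)))
      ... | there (there e∈') = ∈-resp-↭ (↭-sym (↭-pull p q (a , b) L₂)) (there e∈')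
      T : ℚ
      T = totalLen (closure d) ((p ++ q) ++ L₂)
      shorter : totalLen (closure d) (p ++ q ++ (a , b) ∷ L₂) ≤ℚ totalLen (closure d) (p ++ ef ∷ q ++ es ∷ L₂)
      shorter = begin
        totalLen (closure d) (p ++ q ++ (a , b) ∷ L₂)  ≡⟨ totalLen-↭ (closure d) (↭-pull p q (a , b) L₂) ⟩
        d a b +ℚ T                                     ≤⟨ ℚ.+-monoˡ-≤ T (triangle a v b) ⟩
        (d a v +ℚ d v b) +ℚ T
          ≡⟨ cong₂ (λ x y → (x +ℚ y) +ℚ T) (edgeLen-SameEdge ef≈av) (edgeLen-SameEdge es≈vb) ⟨
        (edgeLen ef +ℚ edgeLen es) +ℚ T                ≡⟨ ℚ.+-assoc (edgeLen ef) (edgeLen es) T ⟩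
        edgeLen ef +ℚ (edgeLen es +ℚ T)                ≡⟨ totalLen-↭ (closure d) (↭-pull₂ p ef q es L₂) ⟨
        totalLen (closure d) (p ++ ef ∷ q ++ es ∷ L₂)  ∎
        where open ℚ.≤-Reasoning

    prefix-bypass : ∀ {L} → Prefix L σ → PrefixBypass L
    prefix-bypass pre with Prefix-++-∷ p pre
    ... | inj₁ pre-p = prefix-before pre pre-p
    ... | inj₂ (L₁ , refl , pre₁) with Prefix-++-∷ q pre₁
    ...   | inj₁ pre-q              = prefix-between pre pre-q
    ...   | inj₂ (L₂ , refl , pre₂) = prefix-after pre pre₂

  ConnectsWithin-bypass : ∀ {R : Fin r → Edge n} {t} → v ∉ terminals R →
                          ConnectsWithin (closure d) R σ t → ConnectsWithin (closure d) R σ' t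
  ConnectsWithin-bypass v∉T within i
    with L , pre , conn , L≤t ← within i
    with L' , pre' , B , L'≤L ← prefix-bypass pre
    = L' , pre' , ConnIn-bypass B (proj₁ (∉terminals v∉T i)) (proj₂ (∉terminals v∉T i)) conn , ℚ.≤-trans L'≤L L≤t

-- Bypassing all non-terminal vertices of degree two

branching-or-degree-two : ∀ {H : Network n} {R : Fin r → Edge n} {σ} → IsRForest H R σ →
                          Branching R σ ⊎ ∃ λ v → NonTerminal R σ v × deg v σ ≡ 2
branching-or-degree-two {n} {H = H} {R = R} {σ} forest with any? (λ v → isNonTerminal? R σ v ×-dec (deg v σ ℕ.≟ 2)) (allFin n)
... | yes found = inj₂ (satisfied found)
... | no none   = inj₁ λ v nt →
  ℕ.≤∧≢⇒< (2≤deg {H = H} forest nt) (λ 2≡deg → none (Any.map (λ { refl → nt , sym 2≡deg }) (∈-allFin v)))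

module _ {d : Fin n → Fin n → ℚ} (pm : IsPseudometric d) {R : Fin r → Edge n} {t : Fin r → ℚ} where

  bypass-degree-two : ∀ {σ v} → IsRForest (closure d) R σ → ConnectsWithin (closure d) R σ t →
                      NonTerminal R σ v → deg v σ ≡ 2 →
                      ∃ λ σ' → length σ' < length σ × IsRForest (closure d) R σ' × ConnectsWithin (closure d) R σ' t
  bypass-degree-two {σ} {v} forest within (_ , v∉T) deg≡2
    with p , ef , q , es , s , refl , p-avoids , q-avoids , s-avoids , ef-v , es-v ← filter-two (Inc? v) σ deg≡2
    with a , ef≈av ← otherEnd ef-v
    with b , es≈bv ← otherEnd es-v
    = p ++ q ++ (a , b) ∷ s , shorter , forest' ,
      ConnectsWithin-bypass pm p-avoids q-avoids s-avoids ef≈av (SameEdge-flip es≈bv) ef≉es v∉T within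
    where
    ef≉es : ¬ SameEdge ef es
    ef≉es with ef-distinct ∷ _ ← AllPairs-++⁻ʳ p (proj₂ (proj₁ forest)) = All.lookup ef-distinct (∈-++⁺ʳ q (here refl))
    forest' : IsRForest (closure d) R (p ++ q ++ (a , b) ∷ s)
    forest' = IsRForest-resp-↭ {H = closure d} (↭-sym (↭-pull p q (a , b) s))
                (IsRForest-bypass {d = d} {R = R} (IsRForest-resp-↭ {H = closure d} (↭-pull₂ p ef q es s) forest) v∉T
                                  (++⁺ (++⁺ p-avoids q-avoids) s-avoids) ef≈av (SameEdge-flip es≈bv))
    shorter : length (p ++ q ++ (a , b) ∷ s) < length (p ++ ef ∷ q ++ es ∷ s)
    shorter = ≡.subst₂ _<_ (sym (↭-length (↭-pull p q (a , b) s))) (sym (↭-length (↭-pull₂ p ef q es s))) (ℕ.n<1+n _)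

  reduce : ∀ σ → Acc _<_ (length σ) → IsRForest (closure d) R σ → ConnectsWithin (closure d) R σ t →
           ∃ λ σ̂ → IsRForest (closure d) R σ̂ × ConnectsWithin (closure d) R σ̂ t × Branching R σ̂
  reduce σ (acc rec) forest within with branching-or-degree-two {H = closure d} forest
  ... | inj₁ branching = σ , forest , within , branching
  ... | inj₂ (v , nt , deg≡2) with σ' , shorter , forest' , within' ← bypass-degree-two forest within nt deg≡2 =
    reduce σ' (rec shorter) forest' within'

-- Optimal orderings

listsUpTo : ℕ → List (List (Fin n))
listsUpTo         zero    = [] ∷ []
listsUpTo {n = n} (suc m) = [] ∷ concatMap (λ x → map (x ∷_) (listsUpTo m)) (allFin n)

∈-listsUpTo : ∀ m (ws : List (Fin n)) → length ws ≤ m → ws ∈ listsUpTo m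
∈-listsUpTo zero    []       _         = here refl
∈-listsUpTo (suc m) []       _         = here refl
∈-listsUpTo (suc m) (x ∷ ws) (s≤s len) =
  there (∈-concatMap⁺ (λ x → map (x ∷_) (listsUpTo m))
                      (Any.map (λ { refl → ∈-map⁺ (x ∷_) (∈-listsUpTo m ws len) }) (∈-allFin x)))

Ends? : (u v : Fin n) (ws : List (Fin n)) → Dec (Ends u v ws)
Ends? u v []       = no λ ()
Ends? u v (x ∷ xs) = (u ≟ x) ×-dec (lastOr x xs ≟ v)

IsPath? : (E : List (Edge n)) (u v : Fin n) (ws : List (Fin n)) → Dec (IsPath (EdgeIn E) u v ws)
IsPath? E u v ws = Ends? u v ws ×-dec (allPairs? (λ x y → ¬? (x ≟ y)) ws ×-dec linked? (EdgeIn? E) ws)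

ConnIn? : (E : List (Edge n)) (u v : Fin n) → Dec (ConnIn E u v)
ConnIn? {n} E u v with any? (IsPath? E u v) (listsUpTo n)
... | yes found with ws , _ , P ← find found = yes (ws , P)
... | no none = no λ { (ws , P) → none (Any.map (λ { refl → P }) (∈-listsUpTo n ws (Unique-length (proj₁ (proj₂ P))))) }

least-below : (P : ℕ → Set) → (∀ k → Dec (P k)) → ∀ m →
              (∃ λ k → k < m × P k × (∀ j → j < k → ¬ P j)) ⊎ (∀ j → j < m → ¬ P j)
least-below P P? zero    = inj₂ λ j ()
least-below P P? (suc m) with least-below P P? m
... | inj₁ (k , k<m , pk , least) = inj₁ (k , ℕ.m<n⇒m<1+n k<m , pk , least)
... | inj₂ none with P? m
...   | yes pm = inj₁ (m , ℕ.n<1+n m , pm , none)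
...   | no ¬pm = inj₂ λ j j<1+m → below j (ℕ.m<1+n⇒m<n∨m≡n j<1+m)
  where
  below : ∀ j → j < m ⊎ j ≡ m → ¬ P j
  below j (inj₁ j<m)  = none j j<m
  below j (inj₂ refl) = ¬pm

inserts : A → List A → List (List A)
inserts x []       = (x ∷ []) ∷ []
inserts x (y ∷ ys) = (x ∷ y ∷ ys) ∷ map (y ∷_) (inserts x ys)

permutations : List A → List (List A)
permutations []       = [] ∷ []
permutations (x ∷ xs) = concatMap (inserts x) (permutations xs)

∈-inserts : ∀ (x : A) as bs → as ++ x ∷ bs ∈ inserts x (as ++ bs)
∈-inserts x []       []       = here refl
∈-inserts x []       (b ∷ bs) = here refl
∈-inserts x (a ∷ as) bs       = there (∈-map⁺ (a ∷_) (∈-inserts x as bs))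

inserts-↭ : ∀ (x : A) ys {π} → π ∈ inserts x ys → π ↭ x ∷ ys
inserts-↭ x []       (here refl) = ↭-refl
inserts-↭ x (y ∷ ys) (here refl) = ↭-refl
inserts-↭ x (y ∷ ys) (there π∈) with π' , π'∈ , refl ← ∈-map⁻ (y ∷_) π∈ =
  ↭-trans (↭-prep y (inserts-↭ x ys π'∈)) (↭-swap y x ↭-refl)

∈-permutations : ∀ (xs : List A) {σ} → σ ↭ xs → σ ∈ permutations xs
∈-permutations []       p with refl ← ↭-empty-inv p = here refl
∈-permutations (x ∷ xs) p with as , bs , refl ← ∈-∃++ (∈-resp-↭ (↭-sym p) (here refl)) =
  ∈-concatMap⁺ (inserts x) (Any.map (λ { refl → ∈-inserts x as bs }) (∈-permutations xs (drop-mid as [] p)))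

permutations-↭ : ∀ (xs : List A) {π} → π ∈ permutations xs → π ↭ xs
permutations-↭ []       (here refl) = ↭-refl
permutations-↭ (x ∷ xs) π∈ with π' , π'∈ , π∈ins ← find (∈-concatMap⁻ (inserts x) {xs = permutations xs} π∈) =
  ↭-trans (inserts-↭ x π' π∈ins) (↭-prep x (permutations-↭ xs π'∈))

module _ (f : List A → ℚ) where

  minimalPermutation : List A → List A
  minimalPermutation xs = argmin f xs (permutations xs)

  minimalPermutation-↭ : ∀ xs → minimalPermutation xs ↭ xs
  minimalPermutation-↭ xs with argmin-sel f xs (permutations xs)
  ... | inj₁ π≡xs = subst (_↭ xs) (sym π≡xs) ↭-refl
  ... | inj₂ π∈   = permutations-↭ xs π∈

  minimalPermutation-≤ : ∀ xs {ys} → ys ↭ xs → f (minimalPermutation xs) ≤ℚ f ys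
  minimalPermutation-≤ xs ys↭xs = All.lookup (f[argmin]≤f[xs] xs (permutations xs)) (∈-permutations xs ys↭xs)

module _ {d : Fin n → Fin n → ℚ} (d-nonneg : ∀ u v → 0ℚ ≤ℚ d u v) where

  totalLen-take-mono : ∀ {k k'} τ → k ≤ k' → totalLen (closure d) (take k τ) ≤ℚ totalLen (closure d) (take k' τ)
  totalLen-take-mono {zero}  {k'}     τ        _         = nonneg (take k' τ)
    where
    nonneg : ∀ τ → 0ℚ ≤ℚ totalLen (closure d) τ
    nonneg []      = ℚ.≤-refl
    nonneg (e ∷ τ) = ℚ.≤-trans (nonneg τ) (x≤y+x (d-nonneg _ _))
  totalLen-take-mono {suc k} {suc k'} []       _         = ℚ.≤-refl
  totalLen-take-mono {suc k} {suc k'} (e ∷ τ) (s≤s k≤k') = ℚ.+-monoʳ-≤ (d (proj₁ e) (proj₂ e)) (totalLen-take-mono τ k≤k')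

  -- The value when u and v are not connected by τ is irrelevant.
  connTime : List (Edge n) → Fin n → Fin n → ℚ
  connTime τ u v with least-below (λ k → ConnIn (take k τ) u v) (λ k → ConnIn? (take k τ) u v) (suc (length τ))
  ... | inj₁ (k , _) = totalLen (closure d) (take k τ)
  ... | inj₂ _       = 0ℚ

  connTime-IsConnTime : ∀ τ {u v} → ConnIn τ u v → IsConnTime (closure d) τ (u , v) (connTime τ u v)
  connTime-IsConnTime τ {u} {v} conn
    with least-below (λ k → ConnIn (take k τ) u v) (λ k → ConnIn? (take k τ) u v) (suc (length τ))
  ... | inj₁ (k , _ , conn-k , least) = (k , conn-k , refl) , minimal
    where
    minimal : ∀ k' → ConnIn (take k' τ) u v → totalLen (closure d) (take k τ) ≤ℚ totalLen (closure d) (take k' τ)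
    minimal k' conn-k' with k' ℕ.<? k
    ... | yes k'<k = ⊥-elim (least k' k'<k conn-k')
    ... | no k'≮k  = totalLen-take-mono τ (ℕ.≮⇒≥ k'≮k)
  ... | inj₂ none = ⊥-elim (none (length τ) (ℕ.n<1+n _) (subst (λ L → ConnIn L u v) (sym (take-all (length τ) τ ℕ.≤-refl)) conn))

  module _ {R : Fin r → Edge n} (Φ : (Fin r → ℚ) → ℚ) where

    value : List (Edge n) → ℚ
    value τ = Φ (λ i → connTime τ (proj₁ (R i)) (proj₂ (R i)))

    Connects : List (Edge n) → Set
    Connects τ = ∀ i → ConnIn τ (proj₁ (R i)) (proj₂ (R i))

    value-≤ : Monotone Φ → ∀ {σ t} → Connects σ → ConnectsWithin (closure d) R σ t → value σ ≤ℚ Φ t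
    value-≤ mono {σ} {t} connects within = mono _ t connTime≤
      where
      connTime≤ : ∀ i → connTime σ (proj₁ (R i)) (proj₂ (R i)) ≤ℚ t i
      connTime≤ i with L , pre , conn , L≤t ← within i =
        ℚ.≤-trans (proj₂ (connTime-IsConnTime σ (connects i)) (length L) (subst (λ L' → ConnIn L' _ _) (sym (take-length pre)) conn))
                  (subst (λ L' → totalLen (closure d) L' ≤ℚ t i) (sym (take-length pre)) L≤t)

    IsFValue-exists : Monotone Φ → ∀ F → Connects F → ∃ λ y → IsFValue (closure d) R Φ F y × y ≤ℚ value F
    IsFValue-exists mono F connects = value π , (attained , minimal) , minimalPermutation-≤ value F ↭-refl
      where
      π : List (Edge n)
      π = minimalPermutation value F
      Connects-↭ : ∀ {σ} → σ ↭ F → Connects σ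
      Connects-↭ σ↭F i = ConnIn-⊆ (∈-resp-↭ (↭-sym σ↭F)) (connects i)
      attained : ∃ λ σ → OrderingValue (closure d) R Φ F σ (value π)
      attained = π , minimalPermutation-↭ value F , (λ i → connTime π (proj₁ (R i)) (proj₂ (R i))) ,
                 (λ i → connTime-IsConnTime π (Connects-↭ (minimalPermutation-↭ value F) i)) , refl
      minimal : ∀ σ y → OrderingValue (closure d) R Φ F σ y → value π ≤ℚ y
      minimal σ y (σ↭F , t , times , Φt≡y) =
        ℚ.≤-trans (minimalPermutation-≤ value F σ↭F) (subst (value σ ≤ℚ_) Φt≡y (mono _ t connTime≤))
        where
        connTime≤ : ∀ i → connTime σ (proj₁ (R i)) (proj₂ (R i)) ≤ℚ t i
        connTime≤ i with (k , conn-k , t≡) , _ ← times i =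
          subst (connTime σ (proj₁ (R i)) (proj₂ (R i)) ≤ℚ_) t≡ (proj₂ (connTime-IsConnTime σ (Connects-↭ σ↭F i)) k conn-k)

shortcut-forest : ∀ {G : Network n} {d} {R : Fin r → Edge n} {F σ₀ t₀} →
  IsUndirectedNetwork G → (∀ u v → IsDist G u v (d u v)) → IsRForest G R F → σ₀ ↭ F →
  (∀ i → IsConnTime G σ₀ (R i) (t₀ i)) →
  ∃ λ σ̂ → IsRForest (closure d) R σ̂ × ConnectsWithin (closure d) R σ̂ t₀ × Branching R σ̂
shortcut-forest {G = G} {d} {R} {σ₀ = σ₀} undirected dist forest σ₀↭F times₀ =
  reduce (IsDist⇒IsPseudometric undirected dist) σ₀ (<-wellFounded (length σ₀))
    (IsRForest-resp-↭ {H = closure d} (↭-sym σ₀↭F) (IsRForest-closure {G = G} (proj₁ (proj₂ undirected)) d forest))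
    (ConnectsWithin-closure {G = G} {R = R} (dist≤len undirected dist) (All-resp-↭ (↭-sym σ₀↭F) (proj₁ (proj₁ forest))) times₀)

IsFValue-≤ : ∀ {d : Fin n → Fin n → ℚ} {R : Fin r → Edge n} {Φ σ t x} → IsPseudometric d → Monotone Φ →
             IsRForest (closure d) R σ → ConnectsWithin (closure d) R σ t → Φ t ≡ x →
             ∃ λ y → IsFValue (closure d) R Φ σ y × y ≤ℚ x
IsFValue-≤ {d = d} {R = R} {Φ} {σ} {t} pm mono (_ , _ , connects , _) within refl =
  proj₁ attained , proj₁ (proj₂ attained) , ℚ.≤-trans (proj₂ (proj₂ attained)) value≤
  where
  attained : ∃ λ y → IsFValue (closure d) R Φ σ y × y ≤ℚ value (IsPseudometric.nonneg pm) Φ σ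
  attained = IsFValue-exists (IsPseudometric.nonneg pm) {R = R} Φ mono σ connects
  value≤ : value (IsPseudometric.nonneg pm) {R = R} Φ σ ≤ℚ Φ t
  value≤ = value-≤ (IsPseudometric.nonneg pm) {R = R} Φ mono connects within

numNonTerminal-≤ : ∀ {d : Fin n → Fin n → ℚ} {R : Fin r → Edge n} {σ} → IsRForest (closure d) R σ → Branching R σ →
                   (∀ i → proj₁ (R i) ≢ proj₂ (R i)) → Fin r → numNonTerminal R σ ≤ 2 * r ∸ 2
numNonTerminal-≤ {R = R} ((loopless , distinct) , acyclic , connects , _) branching distinct-ends i =
  nonTerminal-count R (proj₂ (ConnIn-edge (distinct-ends i) (connects i))) (loopless , distinct , acyclic) branching

lemma3 : (n r : ℕ) (G : Network n) (R : Fin r → Edge n) (Φ : (Fin r → ℚ) → ℚ)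
    (d : Fin n → Fin n → ℚ) →
    IsUndirectedNetwork G → Connected G → r ≥ 2 → ValidPairs R → Monotone Φ →
    (∀ (u v : Fin n) → IsDist G u v (d u v)) →
    (F : List (Edge n)) → IsRForest G R F → (x : ℚ) → IsFValue G R Φ F x →
    ∃[ F̂ ] (IsRForest (closure d) R F̂ ×
             (∃[ y ] (IsFValue (closure d) R Φ F̂ y × y ≤ℚ x)) ×
             numNonTerminal R F̂ ≤ 2 * r ∸ 2)
-- Connectivity of G already follows from the distance hypothesis; r ≥ 2 only provides a relevant pair.
lemma3 n r G R Φ d undirected _ (s≤s _) (distinct-ends , _) mono dist F forest x
       ((σ₀ , σ₀↭F , t₀ , times₀ , Φt₀≡x) , _) =
  conclude (shortcut-forest undirected dist forest σ₀↭F times₀)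
  where
  conclude : (∃ λ σ̂ → IsRForest (closure d) R σ̂ × ConnectsWithin (closure d) R σ̂ t₀ × Branching R σ̂) →
             ∃[ F̂ ] (IsRForest (closure d) R F̂ × (∃[ y ] (IsFValue (closure d) R Φ F̂ y × y ≤ℚ x)) ×
                     numNonTerminal R F̂ ≤ 2 * r ∸ 2)
  conclude (σ̂ , forest̂ , within , branching) =
    σ̂ , forest̂ , IsFValue-≤ (IsDist⇒IsPseudometric undirected dist) mono forest̂ within Φt₀≡x ,
    numNonTerminal-≤ {d = d} forest̂ branching distinct-ends Data.Fin.zero
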